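{- Let $G$ be a simple connected graph on $m\ge2$ vertices, and let $\widehat{G}$ be the $m$-th cone over $G$. Then $\mathrm{sn}(\widehat{G})=\mathrm{gon}(\widehat{G})=2m-\alpha(G)$.
   Context: The $m$-th cone over $G$ is obtained from $G$ by adding $m$ new vertices, each joined by a single edge to every other vertex (the original vertices and the other new vertices). $\alpha(G)$ is the independence number of $G$. Scramble number $\mathrm{sn}$: a scramble is a finite collection of nonempty vertex sets (eggs) each inducing a connected subgraph; its order is $\min(h,e)$ where $h$ is the minimum size of a vertex set meeting every egg and $e$ is the minimum of $|E(A,A^C)|$ (number of edges between $A$ and $A^C$) over $A\subseteq V$ containing some egg whose complement contains some egg ($+\infty$ if none); $\mathrm{sn}$ is the maximum order. Gonality: a divisor is an integer combination of vertices; firing a vertex $w$ removes $\mathrm{val}(w)$ chips from $w$ and gives each other vertex one chip per edge to $w$; divisors are equivalent if related by firings; $D$ has positive rank if $D-(v)$ is equivalent to an effective divisor for every vertex $v$; $\mathrm{gon}$ is the minimum degree of a positive rank divisor. -}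

module Defs where

open import Data.Nat as ℕ using (ℕ; zero; suc; _≤_)
open import Data.Integer as ℤ using (ℤ; +_; _-_; _+_)
open import Data.Bool using (Bool; true; false; not; _∧_; if_then_else_)
open import Data.Fin using (Fin; splitAt)
open import Data.Fin.Properties using (_≟_)
open import Data.Fin.Subset using (Subset; _∈_; _∉_; _⊆_; ∁; _∩_; ∣_∣; Nonempty)
open import Data.List using (List; map; foldr; allFin)
open import Data.List.Membership.Propositional renaming (_∈_ to _∈ₗ_)
open import Data.Vec using (lookup)
open import Data.Sum using (_⊎_; inj₁; inj₂)
open import Data.Product using (Σ; ∃; _×_; _,_)
open import Relation.Nullary using (yes; no)
open import Relation.Nullary.Decidable using (⌊_⌋)
open import Relation.Binary.PropositionalEquality using (_≡_; refl; sym)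
open import Relation.Binary.Construct.Closure.ReflexiveTransitive using (Star)
open import Relation.Binary.Construct.Closure.Equivalence using (EqClosure)

record SimpleGraph (n : ℕ) : Set where
  field
    adj    : Fin n → Fin n → Bool
    adjSym : ∀ u v → adj u v ≡ adj v u
    irrefl : ∀ v → adj v v ≡ false
open SimpleGraph public

Connected : ∀ {n} → SimpleGraph n → Set
Connected G = ∀ u v → Star (λ x y → adj G x y ≡ true) u v

-- The m-th cone: add m new vertices (indices n, …, n+m-1 of Fin (n + m)),
-- each joined by one edge to every other vertex.
private
  coneAdj : ∀ {n} → SimpleGraph n → (m : ℕ) → Fin (n ℕ.+ m) → Fin (n ℕ.+ m) → Bool
  coneAdj {n} G m x y with splitAt n x | splitAt n y
  ... | inj₁ u | inj₁ v = adj G u v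
  ... | inj₁ _ | inj₂ _ = true
  ... | inj₂ _ | inj₁ _ = true
  ... | inj₂ i | inj₂ j = not ⌊ i ≟ j ⌋

  eqSym : ∀ {m} (i j : Fin m) → not ⌊ i ≟ j ⌋ ≡ not ⌊ j ≟ i ⌋
  eqSym i j with i ≟ j | j ≟ i
  ... | yes _ | yes _ = refl
  ... | no _  | no _  = refl
  ... | yes p | no q  with q (sym p)
  ... | ()
  eqSym i j | no q | yes p with q (sym p)
  ... | ()

  eqIrr : ∀ {m} (i : Fin m) → not ⌊ i ≟ i ⌋ ≡ false
  eqIrr i with i ≟ i
  ... | yes _ = refl
  ... | no q with q refl
  ... | ()

  coneSym : ∀ {n} (G : SimpleGraph n) m x y → coneAdj G m x y ≡ coneAdj G m y x
  coneSym {n} G m x y with splitAt n x | splitAt n y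
  ... | inj₁ u | inj₁ v = adjSym G u v
  ... | inj₁ _ | inj₂ _ = refl
  ... | inj₂ _ | inj₁ _ = refl
  ... | inj₂ i | inj₂ j = eqSym i j

  coneIrr : ∀ {n} (G : SimpleGraph n) m x → coneAdj G m x x ≡ false
  coneIrr {n} G m x with splitAt n x
  ... | inj₁ u = irrefl G u
  ... | inj₂ i = eqIrr i

cone : ∀ {n} → SimpleGraph n → (m : ℕ) → SimpleGraph (n ℕ.+ m)
cone G m = record { adj = coneAdj G m ; adjSym = coneSym G m ; irrefl = coneIrr G m }

Independent : ∀ {n} → SimpleGraph n → Subset n → Set
Independent G S = ∀ u v → u ∈ S → v ∈ S → adj G u v ≡ false

IsIndependenceNumber : ∀ {n} → SimpleGraph n → ℕ → Set
IsIndependenceNumber G a =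
  (Σ _ λ S → Independent G S × ∣ S ∣ ≡ a) × (∀ S → Independent G S → ∣ S ∣ ≤ a)

sumℕ : List ℕ → ℕ
sumℕ = foldr ℕ._+_ 0

sumℤ : List ℤ → ℤ
sumℤ = foldr _+_ (+ 0)

b2n : Bool → ℕ
b2n true  = 1
b2n false = 0

cutSize : ∀ {n} → SimpleGraph n → Subset n → ℕ
cutSize {n} G A = sumℕ (map (λ u → sumℕ (map (λ v →
  b2n (lookup A u ∧ not (lookup A v) ∧ adj G u v)) (allFin n))) (allFin n))

InducesConnected : ∀ {n} → SimpleGraph n → Subset n → Set
InducesConnected G A =
  ∀ u v → u ∈ A → v ∈ A → Star (λ x y → x ∈ A × y ∈ A × adj G x y ≡ true) u v

IsEgg : ∀ {n} → SimpleGraph n → Subset n → Set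
IsEgg G E = Nonempty E × InducesConnected G E

IsScramble : ∀ {n} → SimpleGraph n → List (Subset n) → Set
IsScramble G S = ∀ E → E ∈ₗ S → IsEgg G E

Hits : ∀ {n} → List (Subset n) → Subset n → Set
Hits S H = ∀ E → E ∈ₗ S → Nonempty (E ∩ H)

Separates : ∀ {n} → List (Subset n) → Subset n → Set
Separates S A = (Σ _ λ E → E ∈ₗ S × E ⊆ A) × (Σ _ λ E → E ∈ₗ S × E ⊆ ∁ A)

-- order of S is ≥ k : min(h, e) ≥ k
OrderAtLeast : ∀ {n} → SimpleGraph n → List (Subset n) → ℕ → Set
OrderAtLeast G S k =
  (∀ H → Hits S H → k ≤ ∣ H ∣) × (∀ A → Separates S A → k ≤ cutSize G A)

OrderAtMost : ∀ {n} → SimpleGraph n → List (Subset n) → ℕ → Set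
OrderAtMost G S k =
  (Σ _ λ H → Hits S H × ∣ H ∣ ≤ k) ⊎ (Σ _ λ A → Separates S A × cutSize G A ≤ k)

IsOrder : ∀ {n} → SimpleGraph n → List (Subset n) → ℕ → Set
IsOrder G S k = OrderAtLeast G S k × OrderAtMost G S k

IsScrambleNumber : ∀ {n} → SimpleGraph n → ℕ → Set
IsScrambleNumber G k =
  (Σ _ λ S → IsScramble G S × IsOrder G S k) ×
  (∀ S o → IsScramble G S → IsOrder G S o → o ≤ k)

Divisor : ℕ → Set
Divisor n = Fin n → ℤ

deg : ∀ {n} → Divisor n → ℤ
deg {n} D = sumℤ (map D (allFin n))

valence : ∀ {n} → SimpleGraph n → Fin n → ℕ
valence {n} G w = sumℕ (map (λ v → b2n (adj G w v)) (allFin n))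

fire : ∀ {n} → SimpleGraph n → Fin n → Divisor n → Divisor n
fire G w D v with v ≟ w
... | yes _ = D v - + valence G w
... | no _  = D v + + b2n (adj G w v)

FiringStep : ∀ {n} → SimpleGraph n → Divisor n → Divisor n → Set
FiringStep G D D′ = Σ _ λ w → ∀ v → D′ v ≡ fire G w D v

Equiv : ∀ {n} → SimpleGraph n → Divisor n → Divisor n → Set
Equiv G = EqClosure (FiringStep G)

Effective : ∀ {n} → Divisor n → Set
Effective D = ∀ v → + 0 ℤ.≤ D v

minusVertex : ∀ {n} → Divisor n → Fin n → Divisor n
minusVertex D v u with u ≟ v
... | yes _ = D u - + 1
... | no _  = D u

PositiveRank : ∀ {n} → SimpleGraph n → Divisor n → Set
PositiveRank G D = ∀ v → Σ _ λ E → Effective E × Equiv G (minusVertex D v) E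

IsGonality : ∀ {n} → SimpleGraph n → ℕ → Set
IsGonality G k =
  (Σ _ λ D → PositiveRank G D × deg D ≡ + k) ×
  (∀ D → PositiveRank G D → + k ℤ.≤ deg D)

module Submission where

-- Let I be a maximum independent set of G, α = ∣I∣, and C the set of all vertices of the cone
-- outside I: a vertex cover of size 2m − α whose remaining vertices have valence at most 2m − α.
-- Hence the indicator divisor of C has positive rank (a vertex of I can borrow from its
-- neighbours, which all lie in C), and every scramble has order at most 2m − α: either C meets
-- every egg, or some egg lies in the independent set I, so is a single vertex v, and then {v}
-- either meets every egg or cuts off an egg along valence(v) edges.  Conversely the scramble of
-- apex singletons and edges of G has order 2m − α: a hitting set contains every apex and a
-- vertex cover of G, and any cut separating two eggs has at least 2m − 1 edges.
--
-- For the gonality, a divisor of positive rank is equivalent to an effective divisor D of the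
-- same degree.  If deg D < 2m − α, counting the zeros of D yields adjacent chip-free vertices
-- v and x not adjacent to any heavy vertex (one holding at least its valence in chips).  Dhar's
-- burning argument shows that then D − (v) is not equivalent to an effective divisor: in the
-- cone a set with a cut of fewer than 2m − 1 edges that misses two vertices is a singleton, so
-- every strict superlevel set of a firing script that reaches an effective divisor is a single
-- heavy vertex.

open import Defs
open import Data.Nat as ℕ using (ℕ; zero; suc; z≤n; s≤s; _≤_; _+_; _∸_)
import Data.Nat.Properties as ℕP
open import Data.Integer as ℤ using (ℤ; +_; +≤+)
import Data.Integer.Properties as ℤP
open import Data.Bool using (Bool; true; false; not; _∧_; _∨_; if_then_else_)
open import Data.Fin using (Fin; zero; suc; _↑ˡ_; _↑ʳ_; splitAt; fromℕ<)
open import Data.Fin.Properties using (_≟_; suc-injective; any?; splitAt-↑ˡ; splitAt-↑ʳ; splitAt⁻¹-↑ˡ; splitAt⁻¹-↑ʳ; ↑ˡ-injective)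
import Data.Bool.Properties as Bool
open import Data.Fin.Subset using (Subset; ∣_∣; ⁅_⁆; _∈_; _∩_; _∪_; ∁; _⊆_; Nonempty)
open import Data.Fin.Subset.Properties using (∣p∣≤n; ∣∁p∣≡n∸∣p∣; x∈⁅x⁆; x∈⁅y⁆⇒x≡y; ∣⁅x⁆∣≡1; x∈p∩q⁺; x∈p∩q⁻; x∈p∪q⁺; x∈p∪q⁻; nonempty?; _⊆?_; _∈?_; x∉p⇒x∈∁p; x∈∁p⇒x∉p)
import Data.List as List
open import Data.List.Membership.Propositional using (find; lose) renaming (_∈_ to _∈ₗ_)
open import Data.List.Membership.Propositional.Properties using (∈-map⁺; ∈-map⁻; ∈-++⁺ˡ; ∈-++⁺ʳ; ∈-++⁻; ∈-filter⁺; ∈-filter⁻; ∈-allFin; ∈-cartesianProduct⁺)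
open import Data.List.Relation.Unary.All using (all?) renaming (lookup to lookupAll)
open import Data.List.Relation.Unary.All.Properties using (¬All⇒Any¬)
import Data.List.Relation.Unary.Any as Any
open import Data.List.Properties using (map-tabulate; map-cong)
open import Data.Vec using ([]; _∷_; lookup; tabulate)
open import Data.Vec.Properties using (lookup∘tabulate; lookup-map; []=⇒lookup; lookup⇒[]=)
import Data.Vec.Functional as Vector
open import Data.Product using (Σ; _×_; _,_; proj₁; proj₂)
open import Data.Sum using (_⊎_; inj₁; inj₂; [_,_]′)
open import Relation.Nullary using (Dec; does; yes; no; ¬_; ¬?)
open import Relation.Nullary.Decidable using (⌊_⌋; _×-dec_; dec-true; dec-false)
open import Relation.Binary.PropositionalEquality
open import Data.Integer.Solver using (module +-*-Solver)
open +-*-Solver using (solve; _:+_; _:-_; :-_; _:=_; con)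
open import Relation.Binary.Construct.Closure.ReflexiveTransitive using (ε; _◅_)
open import Relation.Binary.Construct.Closure.Symmetric using (SymClosure; fwd; bwd)
open import Data.Empty using (⊥; ⊥-elim)
open import Function using (_∘_)
open import Data.Nat.Tactic.RingSolver using (solve-∀)

import Algebra.Properties.CommutativeMonoid.Sum

open import Algebra.Properties.CommutativeSemigroup ℕP.+-commutativeSemigroup using (xy∙z≈xz∙y)

module ΣN = Algebra.Properties.CommutativeMonoid.Sum ℕP.+-0-commutativeMonoid
module ΣZ = Algebra.Properties.CommutativeMonoid.Sum ℤP.+-0-commutativeMonoid

Σℕ : ∀ {n} → (Fin n → ℕ) → ℕ
Σℕ = ΣN.sum

Σℤ : ∀ {n} → (Fin n → ℤ) → ℤ
Σℤ = ΣZ.sum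

foldr-map-allFin : ∀ {A : Set} (_∙_ : A → A → A) (e : A) {n} (h : Fin n → A) →
                   List.foldr _∙_ e (List.map h (List.allFin n)) ≡ Vector.foldr _∙_ e h
foldr-map-allFin {A} _∙_ e {n} h = trans (cong (List.foldr _∙_ e) (map-tabulate (λ i → i) h)) (go h)
  where
  go : ∀ {k} (g : Fin k → A) → List.foldr _∙_ e (List.tabulate g) ≡ Vector.foldr _∙_ e g
  go {zero}  g = refl
  go {suc k} g = cong (g zero ∙_) (go (g ∘ suc))

sumℕ-allFin : ∀ {n} (h : Fin n → ℕ) → sumℕ (List.map h (List.allFin n)) ≡ Σℕ h
sumℕ-allFin = foldr-map-allFin ℕ._+_ 0

sumℤ-allFin : ∀ {n} (h : Fin n → ℤ) → sumℤ (List.map h (List.allFin n)) ≡ Σℤ h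
sumℤ-allFin = foldr-map-allFin ℤ._+_ (+ 0)

Σℕ-mono-≤ : ∀ {n} {f g : Fin n → ℕ} → (∀ i → f i ≤ g i) → Σℕ f ≤ Σℕ g
Σℕ-mono-≤ {zero}  f≤g = z≤n
Σℕ-mono-≤ {suc n} f≤g = ℕP.+-mono-≤ (f≤g zero) (Σℕ-mono-≤ (f≤g ∘ suc))

Σℤ-mono-≤ : ∀ {n} {f g : Fin n → ℤ} → (∀ i → f i ℤ.≤ g i) → Σℤ f ℤ.≤ Σℤ g
Σℤ-mono-≤ {zero}  f≤g = ℤP.≤-refl
Σℤ-mono-≤ {suc n} f≤g = ℤP.+-mono-≤ (f≤g zero) (Σℤ-mono-≤ (f≤g ∘ suc))

Σℕ-mono-except : ∀ {n} {f g : Fin n → ℕ} w {x y} → (∀ i → i ≢ w → f i ≤ g i) → f w + x ≤ g w + y →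
                 Σℕ f + x ≤ Σℕ g + y
Σℕ-mono-except {suc n} {f} {g} zero {x} {y} f≤g at-w = begin
  f zero + Σℕ (f ∘ suc) + x  ≡⟨ xy∙z≈xz∙y (f zero) _ x ⟩
  f zero + x + Σℕ (f ∘ suc)  ≤⟨ ℕP.+-mono-≤ at-w (Σℕ-mono-≤ (λ i → f≤g (suc i) λ ())) ⟩
  g zero + y + Σℕ (g ∘ suc)  ≡⟨ xy∙z≈xz∙y (g zero) y _ ⟩
  g zero + Σℕ (g ∘ suc) + y  ∎
  where open ℕP.≤-Reasoning
Σℕ-mono-except {suc n} {f} {g} (suc w) {x} {y} f≤g at-w = begin
  f zero + Σℕ (f ∘ suc) + x    ≡⟨ ℕP.+-assoc (f zero) _ x ⟩
  f zero + (Σℕ (f ∘ suc) + x)  ≤⟨ ℕP.+-mono-≤ (f≤g zero λ ()) (Σℕ-mono-except w (λ i i≢w → f≤g (suc i) (i≢w ∘ suc-injective)) at-w) ⟩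
  g zero + (Σℕ (g ∘ suc) + y)  ≡⟨ ℕP.+-assoc (g zero) _ y ⟨
  g zero + Σℕ (g ∘ suc) + y    ∎
  where open ℕP.≤-Reasoning

Σℕ-ones : ∀ n → Σℕ {n} (λ _ → 1) ≡ n
Σℕ-ones zero    = refl
Σℕ-ones (suc n) = cong suc (Σℕ-ones n)

Σℤ-neg : ∀ {n} (f : Fin n → ℤ) → Σℤ (λ i → ℤ.- f i) ≡ ℤ.- Σℤ f
Σℤ-neg {zero}  f = refl
Σℤ-neg {suc n} f = trans (cong (λ s → ℤ.- f zero ℤ.+ s) (Σℤ-neg (f ∘ suc))) (sym (ℤP.neg-distrib-+ (f zero) _))

Σℤ-fromℕ : ∀ {n} (f : Fin n → ℕ) → Σℤ (λ i → + f i) ≡ + Σℕ f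
Σℤ-fromℕ {zero}  f = refl
Σℤ-fromℕ {suc n} f = cong (λ s → + f zero ℤ.+ s) (Σℤ-fromℕ (f ∘ suc))

Σℕ-single : ∀ {n} (f : Fin n → ℕ) w → (∀ i → i ≢ w → f i ≡ 0) → Σℕ f ≡ f w
Σℕ-single {suc n} f zero    f≡0 = trans (cong (λ s → f zero + s) rest≡0) (ℕP.+-identityʳ (f zero))
  where
  rest≡0 : Σℕ (f ∘ suc) ≡ 0
  rest≡0 = trans (ΣN.sum-cong-≗ (λ i → f≡0 (suc i) λ ())) (ΣN.sum-replicate-zero n)
Σℕ-single {suc n} f (suc w) f≡0 = cong₂ _+_ (f≡0 zero λ ()) (Σℕ-single (f ∘ suc) w λ i i≢w → f≡0 (suc i) (i≢w ∘ suc-injective))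

Σℤ-single : ∀ {n} (f : Fin n → ℤ) w → (∀ i → i ≢ w → f i ≡ + 0) → Σℤ f ≡ f w
Σℤ-single {suc n} f zero    f≡0 = trans (cong (λ s → f zero ℤ.+ s) rest≡0) (ℤP.+-identityʳ (f zero))
  where
  rest≡0 : Σℤ (f ∘ suc) ≡ + 0
  rest≡0 = trans (ΣZ.sum-cong-≗ (λ i → f≡0 (suc i) λ ())) (ΣZ.sum-replicate-zero n)
Σℤ-single {suc n} f (suc w) f≡0 = trans (cong₂ ℤ._+_ (f≡0 zero λ ()) rest) (ℤP.+-identityˡ (f (suc w)))
  where
  rest : Σℤ (f ∘ suc) ≡ f (suc w)
  rest = Σℤ-single (f ∘ suc) w λ i i≢w → f≡0 (suc i) (i≢w ∘ suc-injective)

term≤Σℕ : ∀ {n} (f : Fin n → ℕ) w → f w ≤ Σℕ f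
term≤Σℕ f zero    = ℕP.m≤m+n _ _
term≤Σℕ f (suc w) = ℕP.≤-trans (term≤Σℕ (f ∘ suc) w) (ℕP.m≤n+m _ (f zero))

two-terms≤Σℕ : ∀ {n} (f : Fin n → ℕ) {v w} → v ≢ w → f v + f w ≤ Σℕ f
two-terms≤Σℕ f {zero}  {zero}  v≢w = ⊥-elim (v≢w refl)
two-terms≤Σℕ f {zero}  {suc w} v≢w = ℕP.+-monoʳ-≤ (f zero) (term≤Σℕ (f ∘ suc) w)
two-terms≤Σℕ f {suc v} {zero}  v≢w = ℕP.≤-trans (ℕP.≤-reflexive (ℕP.+-comm (f (suc v)) (f zero))) (two-terms≤Σℕ f {zero} {suc v} λ ())
two-terms≤Σℕ f {suc v} {suc w} v≢w = ℕP.≤-trans (two-terms≤Σℕ (f ∘ suc) (v≢w ∘ cong suc)) (ℕP.m≤n+m _ (f zero))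

0≤Σℤ : ∀ {n} (f : Fin n → ℤ) → (∀ i → + 0 ℤ.≤ f i) → + 0 ℤ.≤ Σℤ f
0≤Σℤ {n} f 0≤f = subst (ℤ._≤ Σℤ f) (ΣZ.sum-replicate-zero n) (Σℤ-mono-≤ 0≤f)

term≤Σℤ : ∀ {n} (f : Fin n → ℤ) → (∀ i → + 0 ℤ.≤ f i) → ∀ w → f w ℤ.≤ Σℤ f
term≤Σℤ f 0≤f zero    = subst (ℤ._≤ Σℤ f) (ℤP.+-identityʳ (f zero)) (ℤP.+-monoʳ-≤ (f zero) (0≤Σℤ (f ∘ suc) (0≤f ∘ suc)))
term≤Σℤ f 0≤f (suc w) = subst (ℤ._≤ Σℤ f) (ℤP.+-identityˡ (f (suc w))) (ℤP.+-mono-≤ (0≤f zero) (term≤Σℤ (f ∘ suc) (0≤f ∘ suc) w))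

Σℕ-splitAt : ∀ m {k} (f : Fin (m + k) → ℕ) → Σℕ f ≡ Σℕ (λ i → f (i ↑ˡ k)) + Σℕ (λ j → f (m ↑ʳ j))
Σℕ-splitAt zero    f = refl
Σℕ-splitAt (suc m) f = trans (cong (λ s → f zero + s) (Σℕ-splitAt m (f ∘ suc))) (sym (ℕP.+-assoc (f zero) _ _))

∣p∣≡Σℕ : ∀ {n} (p : Subset n) → ∣ p ∣ ≡ Σℕ (b2n ∘ lookup p)
∣p∣≡Σℕ []          = refl
∣p∣≡Σℕ (true ∷ p)  = cong suc (∣p∣≡Σℕ p)
∣p∣≡Σℕ (false ∷ p) = ∣p∣≡Σℕ p

x≡-x⇒x≡0 : ∀ {x} → x ≡ ℤ.- x → x ≡ + 0
x≡-x⇒x≡0 {+ zero} _ = refl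

Σ²-antisym : ∀ {n} (g : Fin n → Fin n → ℤ) → (∀ y z → g z y ≡ ℤ.- g y z) → Σℤ (λ y → Σℤ (g y)) ≡ + 0
Σ²-antisym g anti = x≡-x⇒x≡0 (begin
  Σℤ (λ y → Σℤ (g y))          ≡⟨ ΣZ.∑-comm g ⟩
  Σℤ (λ z → Σℤ (λ y → g y z))  ≡⟨ ΣZ.sum-cong-≗ (λ z → trans (ΣZ.sum-cong-≗ (anti z)) (Σℤ-neg (g z))) ⟩
  Σℤ (λ z → ℤ.- Σℤ (g z))      ≡⟨ Σℤ-neg (λ z → Σℤ (g z)) ⟩
  ℤ.- Σℤ (λ y → Σℤ (g y))      ∎)
  where open ≡-Reasoning

<⇒1≤- : ∀ {i j} → i ℤ.< j → + 1 ℤ.≤ j ℤ.- i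
<⇒1≤- {i} {j} i<j = subst (ℤ._≤ j ℤ.- i) (solve 1 (λ x → (con (+ 1) :+ x) :- x := con (+ 1)) refl i) (ℤP.+-monoˡ-≤ (ℤ.- i) (ℤP.i<j⇒suc[i]≤j i<j))

Σℤ-if : ∀ {n} b (f : Fin n → ℤ) → Σℤ (λ i → if b then f i else + 0) ≡ (if b then Σℤ f else + 0)
Σℤ-if {n} true  f = refl
Σℤ-if {n} false f = ΣZ.sum-replicate-zero n

if-∧-split : ∀ b c (x : ℤ) → (if b ∧ c then x else + 0) ℤ.+ (if b ∧ not c then x else + 0) ≡ (if b then x else + 0)
if-∧-split true  true  x = ℤP.+-identityʳ x
if-∧-split true  false x = ℤP.+-identityˡ x
if-∧-split false c     x = refl

b2n+b2n∘not : ∀ b → b2n b + b2n (not b) ≡ 1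
b2n+b2n∘not true  = refl
b2n+b2n∘not false = refl

b2n≤1 : ∀ b → b2n b ≤ 1
b2n≤1 true  = ℕP.≤-refl
b2n≤1 false = z≤n

δ : ∀ {n} → Fin n → Fin n → ℕ
δ w y = b2n ⌊ y ≟ w ⌋

δ-diag : ∀ {n} (w : Fin n) → δ w w ≡ 1
δ-diag w with w ≟ w
... | yes _  = refl
... | no w≢w = ⊥-elim (w≢w refl)

δ-off : ∀ {n} {w y : Fin n} → y ≢ w → δ w y ≡ 0
δ-off {w = w} {y} y≢w with y ≟ w
... | yes y≡w = ⊥-elim (y≢w y≡w)
... | no _    = refl

Σℕ-δ : ∀ {n} (w : Fin n) → Σℕ (δ w) ≡ 1
Σℕ-δ w = trans (Σℕ-single (δ w) w λ _ → δ-off) (δ-diag w)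

member≢nonmember : ∀ {n} (T : Subset n) {u v} → lookup T u ≡ true → lookup T v ≡ false → u ≢ v
member≢nonmember T u∈T v∉T refl with trans (sym u∈T) v∉T
... | ()

∈⇒lookup : ∀ {n} {x : Fin n} {E A} → E ⊆ A → x ∈ E → lookup A x ≡ true
∈⇒lookup E⊆A x∈E = []=⇒lookup (E⊆A x∈E)

∈∁⇒lookup : ∀ {n} {x : Fin n} {E A} → E ⊆ ∁ A → x ∈ E → lookup A x ≡ false
∈∁⇒lookup {x = x} {A = A} E⊆∁A x∈E = Bool.¬-not (λ x∈A → x∈∁p⇒x∉p (E⊆∁A x∈E) (lookup⇒[]= x A x∈A))

∉⇒⊆∁⁅⁆ : ∀ {n} {v : Fin n} {E} → ¬ v ∈ E → E ⊆ ∁ ⁅ v ⁆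
∉⇒⊆∁⁅⁆ {v = v} {E} v∉E x∈E = x∉p⇒x∈∁p (λ x∈v → v∉E (subst (_∈ E) (x∈⁅y⁆⇒x≡y v x∈v) x∈E))

hit-singleton : ∀ {n} {w : Fin n} {H} → Nonempty (⁅ w ⁆ ∩ H) → lookup H w ≡ true
hit-singleton {w = w} {H} (x , x∈) with x∈p∩q⁻ ⁅ w ⁆ H x∈
... | x∈w , x∈H rewrite x∈⁅y⁆⇒x≡y w x∈w = []=⇒lookup x∈H

∈pair⁻ : ∀ {n} {u w x : Fin n} → x ∈ ⁅ u ⁆ ∪ ⁅ w ⁆ → x ≡ u ⊎ x ≡ w
∈pair⁻ {u = u} {w} x∈ with x∈p∪q⁻ ⁅ u ⁆ ⁅ w ⁆ x∈
... | inj₁ x∈u = inj₁ (x∈⁅y⁆⇒x≡y u x∈u)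
... | inj₂ x∈w = inj₂ (x∈⁅y⁆⇒x≡y w x∈w)

left∈pair : ∀ {n} (u w : Fin n) → u ∈ ⁅ u ⁆ ∪ ⁅ w ⁆
left∈pair u w = x∈p∪q⁺ (inj₁ (x∈⁅x⁆ u))

right∈pair : ∀ {n} (u w : Fin n) → w ∈ ⁅ u ⁆ ∪ ⁅ w ⁆
right∈pair u w = x∈p∪q⁺ (inj₂ (x∈⁅x⁆ w))

hit-pair : ∀ {n} {u w : Fin n} {H} → Nonempty ((⁅ u ⁆ ∪ ⁅ w ⁆) ∩ H) → lookup H u ≡ true ⊎ lookup H w ≡ true
hit-pair {u = u} {w} {H} (x , x∈) with x∈p∩q⁻ (⁅ u ⁆ ∪ ⁅ w ⁆) H x∈
... | x∈pair , x∈H with ∈pair⁻ x∈pair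
...   | inj₁ refl = inj₁ ([]=⇒lookup x∈H)
...   | inj₂ refl = inj₂ ([]=⇒lookup x∈H)

order-bound : ∀ {n} {H : SimpleGraph n} {Sc o k} → OrderAtLeast H Sc o → OrderAtMost H Sc k → o ≤ k
order-bound (hitting≥ , _) (inj₁ (A , hits , ∣A∣≤k))    = ℕP.≤-trans (hitting≥ A hits) ∣A∣≤k
order-bound (_ , cut≥)     (inj₂ (A , separates , cut≤k)) = ℕP.≤-trans (cut≥ A separates) cut≤k

χ : ∀ {n} → Fin n → Fin n → ℤ
χ w y = + δ w y

minusVertex≡ : ∀ {n} (D : Divisor n) v y → minusVertex D v y ≡ D y ℤ.- χ v y
minusVertex≡ D v y with y ≟ v
... | yes _ = refl
... | no _  = sym (ℤP.+-identityʳ (D y))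

indicator : ∀ {n} → Subset n → Divisor n
indicator S y = + b2n (lookup S y)

deg-indicator : ∀ {n} (S : Subset n) → deg (indicator S) ≡ + ∣ S ∣
deg-indicator S = trans (sumℤ-allFin (indicator S)) (trans (Σℤ-fromℕ (b2n ∘ lookup S)) (cong +_ (sym (∣p∣≡Σℕ S))))

restrict : ∀ {n} → Subset n → (Fin n → ℤ) → Fin n → ℤ
restrict T f y = if lookup T y then f y else + 0

restrict-mono-≤ : ∀ {n} T {f g : Fin n → ℤ} → (∀ y → f y ℤ.≤ g y) → ∀ y → restrict T f y ℤ.≤ restrict T g y
restrict-mono-≤ T f≤g y with lookup T y
... | true  = f≤g y
... | false = ℤP.≤-refl

Σrestrict≤Σ : ∀ {n} T (D : Fin n → ℕ) → Σℤ (restrict T (+_ ∘ D)) ℤ.≤ + Σℕ D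
Σrestrict≤Σ T D = ℤP.≤-trans (Σℤ-mono-≤ restrict≤) (ℤP.≤-reflexive (Σℤ-fromℕ D))
  where
  restrict≤ : ∀ y → restrict T (+_ ∘ D) y ℤ.≤ + D y
  restrict≤ y with lookup T y
  ... | true  = ℤP.≤-refl
  ... | false = +≤+ z≤n

Σrestrict-singleton : ∀ {n} T z (f : Fin n → ℤ) → (∀ u → lookup T u ≡ true → u ≡ z) → lookup T z ≡ true →
                      Σℤ (restrict T f) ≡ f z
Σrestrict-singleton T z f only z∈T = trans (Σℤ-single (restrict T f) z outside) (cong (λ b → if b then f z else + 0) z∈T)
  where
  outside : ∀ u → u ≢ z → restrict T f u ≡ + 0
  outside u u≢z with lookup T u in u∈T
  ... | true  = ⊥-elim (u≢z (only u u∈T))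
  ... | false = refl

above : ∀ {n} → (Fin n → ℤ) → ℤ → Subset n
above f t = tabulate (λ y → does (t ℤP.<? f y))

module _ {n} (f : Fin n → ℤ) (t : ℤ) where

  ∈above⁺ : ∀ {y} → t ℤ.< f y → lookup (above f t) y ≡ true
  ∈above⁺ {y} t<fy = trans (lookup∘tabulate _ y) (dec-true (t ℤP.<? f y) t<fy)

  ∉above⁺ : ∀ {y} → f y ℤ.≤ t → lookup (above f t) y ≡ false
  ∉above⁺ {y} fy≤t = trans (lookup∘tabulate _ y) (dec-false (t ℤP.<? f y) (ℤP.≤⇒≯ fy≤t))

  ∈above⁻ : ∀ {y} → lookup (above f t) y ≡ true → t ℤ.< f y
  ∈above⁻ {y} y∈ with t ℤP.<? f y
  ... | yes t<fy = t<fy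
  ... | no  t≮fy with trans (sym y∈) (∉above⁺ (ℤP.≮⇒≥ t≮fy))
  ...   | ()

  ∉above⁻ : ∀ {y} → lookup (above f t) y ≡ false → f y ℤ.≤ t
  ∉above⁻ {y} y∉ with t ℤP.<? f y
  ... | no  t≮fy = ℤP.≮⇒≥ t≮fy
  ... | yes t<fy with trans (sym y∉) (∈above⁺ t<fy)
  ...   | ()

-- Cuts, the Laplacian and firing scripts

module _ {n} (H : SimpleGraph n) where

  adj⇒≢ : ∀ {u v} → adj H u v ≡ true → u ≢ v
  adj⇒≢ {u} uv refl with trans (sym uv) (irrefl H u)
  ... | ()

  adj-both : ∀ {u v} → adj H u v ≡ true → adj H v u ≢ false
  adj-both {u} {v} uv vu with trans (sym uv) (trans (adjSym H u v) vu)
  ... | ()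

  crosses : Subset n → Fin n → Fin n → ℕ
  crosses T u v = b2n (lookup T u ∧ not (lookup T v) ∧ adj H u v)

  cutSize≡Σ : ∀ T → cutSize H T ≡ Σℕ (λ u → Σℕ (crosses T u))
  cutSize≡Σ T = trans (cong sumℕ (map-cong (λ u → sumℕ-allFin (crosses T u)) (List.allFin n))) (sumℕ-allFin (λ u → Σℕ (crosses T u)))

  valence≡Σ : ∀ w → valence H w ≡ Σℕ (b2n ∘ adj H w)
  valence≡Σ w = sumℕ-allFin (b2n ∘ adj H w)

  cutSize-singleton : ∀ T z → lookup T z ≡ true → (∀ u → lookup T u ≡ true → u ≡ z) →
                      cutSize H T ≡ valence H z
  cutSize-singleton T z z∈T only = begin
    cutSize H T                     ≡⟨ cutSize≡Σ T ⟩
    Σℕ (λ u → Σℕ (crosses T u))     ≡⟨ Σℕ-single _ z outside ⟩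
    Σℕ (crosses T z)                ≡⟨ ΣN.sum-cong-≗ edge ⟩
    Σℕ (b2n ∘ adj H z)              ≡⟨ sym (valence≡Σ z) ⟩
    valence H z                     ∎
    where
    outside : ∀ u → u ≢ z → Σℕ (crosses T u) ≡ 0
    outside u u≢z with lookup T u in u∈T
    ... | true  = ⊥-elim (u≢z (only u u∈T))
    ... | false = ΣN.sum-replicate-zero n
    edge : ∀ v → crosses T z v ≡ b2n (adj H z v)
    edge v rewrite z∈T with lookup T v in v∈T
    ... | false = refl
    ... | true rewrite only v v∈T | irrefl H z = refl
    open ≡-Reasoning

  two-rows≤cut : ∀ T {u w} → u ≢ w → Σℕ (crosses T u) + Σℕ (crosses T w) ≤ cutSize H T
  two-rows≤cut T {u} {w} u≢w = subst (Σℕ (crosses T u) + Σℕ (crosses T w) ≤_) (sym (cutSize≡Σ T)) (two-terms≤Σℕ (λ u → Σℕ (crosses T u)) u≢w)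

  two-columns≤cut : ∀ T {u w} → u ≢ w → Σℕ (λ y → crosses T y u) + Σℕ (λ y → crosses T y w) ≤ cutSize H T
  two-columns≤cut T {u} {w} u≢w = subst (Σℕ (λ y → crosses T y u) + Σℕ (λ y → crosses T y w) ≤_) (sym (trans (cutSize≡Σ T) (ΣN.∑-comm (crosses T))))
                                (two-terms≤Σℕ (λ v → Σℕ (λ y → crosses T y v)) u≢w)

  cut-hub : ∀ T {c c′} → lookup T c ≡ true → lookup T c′ ≡ false →
            (∀ v → lookup T v ≡ false → adj H c v ≡ true) → (∀ u → lookup T u ≡ true → adj H u c′ ≡ true) →
            n ≤ 1 + cutSize H T
  cut-hub T {c} {c′} c∈T c′∉T c-sees-out c′-sees-in = begin
    n                                                   ≡⟨ trans (sym (Σℕ-ones n)) (ΣN.sum-cong-≗ (λ u → sym (b2n+b2n∘not (lookup T u)))) ⟩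
    Σℕ (λ u → b2n (lookup T u) + b2n (not (lookup T u))) ≡⟨ ΣN.∑-distrib-+ (b2n ∘ lookup T) (b2n ∘ not ∘ lookup T) ⟩
    Σℕ (b2n ∘ lookup T) + Σℕ (b2n ∘ not ∘ lookup T)     ≤⟨ Σℕ-mono-except c in≤row at-c ⟩
    Σℕ (λ u → Σℕ (crosses T u)) + 1                     ≡⟨ cong (_+ 1) (cutSize≡Σ T) ⟨
    cutSize H T + 1                                     ≡⟨ ℕP.+-comm (cutSize H T) 1 ⟩
    1 + cutSize H T                                     ∎
    where
    open ℕP.≤-Reasoning
    in≤row : ∀ u → u ≢ c → b2n (lookup T u) ≤ Σℕ (crosses T u)
    in≤row u _ = ℕP.≤-trans in≤crosses-c′ (term≤Σℕ (crosses T u) c′)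
      where
      in≤crosses-c′ : b2n (lookup T u) ≤ crosses T u c′
      in≤crosses-c′ rewrite c′∉T with lookup T u in u∈T
      ... | false = z≤n
      ... | true rewrite c′-sees-in u u∈T = ℕP.≤-refl
    row-c : ∀ v → b2n (not (lookup T v)) ≡ crosses T c v
    row-c v rewrite c∈T with lookup T v in v∈T
    ... | true  = refl
    ... | false rewrite c-sees-out v v∈T = refl
    at-c : b2n (lookup T c) + Σℕ (b2n ∘ not ∘ lookup T) ≤ Σℕ (crosses T c) + 1
    at-c = subst (λ b → b2n b + Σℕ (b2n ∘ not ∘ lookup T) ≤ Σℕ (crosses T c) + 1) (sym c∈T)
                 (ℕP.≤-reflexive (trans (ℕP.+-comm 1 _) (cong (_+ 1) (ΣN.sum-cong-≗ row-c))))

  cutSize-⁅⁆ : ∀ v → cutSize H ⁅ v ⁆ ≡ valence H v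
  cutSize-⁅⁆ v = cutSize-singleton ⁅ v ⁆ v ([]=⇒lookup (x∈⁅x⁆ v)) (λ u u∈ → x∈⁅y⁆⇒x≡y v (lookup⇒[]= u ⁅ v ⁆ u∈))

  ∇ : (Fin n → ℤ) → Fin n → Fin n → ℤ
  ∇ f y z = if adj H y z then f y ℤ.- f z else + 0

  Δ : (Fin n → ℤ) → Fin n → ℤ
  Δ f y = Σℤ (∇ f y)


  ∇-antisym : ∀ f y z → ∇ f z y ≡ ℤ.- ∇ f y z
  ∇-antisym f y z rewrite adjSym H z y with adj H y z
  ... | false = refl
  ... | true  = solve 2 (λ a b → b :- a := :- (a :- b)) refl (f y) (f z)

  ΣΔ≡0 : ∀ f → Σℤ (Δ f) ≡ + 0
  ΣΔ≡0 f = Σ²-antisym (∇ f) (∇-antisym f)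

  Δ-+ : ∀ f g y → Δ (λ z → f z ℤ.+ g z) y ≡ Δ f y ℤ.+ Δ g y
  Δ-+ f g y = trans (ΣZ.sum-cong-≗ pointwise) (ΣZ.∑-distrib-+ (∇ f y) (∇ g y))
    where
    pointwise : ∀ z → ∇ (λ z → f z ℤ.+ g z) y z ≡ ∇ f y z ℤ.+ ∇ g y z
    pointwise z with adj H y z
    ... | false = refl
    ... | true  = solve 4 (λ a b c d → (a :+ b) :- (c :+ d) := (a :- c) :+ (b :- d)) refl (f y) (g y) (f z) (g z)

  Δ-neg : ∀ f y → Δ (λ z → ℤ.- f z) y ≡ ℤ.- Δ f y
  Δ-neg f y = trans (ΣZ.sum-cong-≗ pointwise) (Σℤ-neg (∇ f y))
    where
    pointwise : ∀ z → ∇ (λ z → ℤ.- f z) y z ≡ ℤ.- ∇ f y z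
    pointwise z with adj H y z
    ... | false = refl
    ... | true  = solve 2 (λ a b → (:- a) :- (:- b) := :- (a :- b)) refl (f y) (f z)

  Δ-sub : ∀ f g y → Δ (λ z → f z ℤ.- g z) y ≡ Δ f y ℤ.- Δ g y
  Δ-sub f g y = trans (Δ-+ f (λ z → ℤ.- g z) y) (cong (λ s → Δ f y ℤ.+ s) (Δ-neg g y))

  Δ-0 : ∀ y → Δ (λ _ → + 0) y ≡ + 0
  Δ-0 y = trans (ΣZ.sum-cong-≗ pointwise) (ΣZ.sum-replicate-zero n)
    where
    pointwise : ∀ z → ∇ (λ _ → + 0) y z ≡ + 0
    pointwise z with adj H y z
    ... | false = refl
    ... | true  = refl

  Δχ-diag : ∀ w → Δ (χ w) w ≡ + valence H w
  Δχ-diag w = begin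
    Δ (χ w) w                     ≡⟨ ΣZ.sum-cong-≗ pointwise ⟩
    Σℤ (λ z → + b2n (adj H w z))  ≡⟨ Σℤ-fromℕ (b2n ∘ adj H w) ⟩
    + Σℕ (b2n ∘ adj H w)          ≡⟨ cong +_ (valence≡Σ w) ⟨
    + valence H w                 ∎
    where
    open ≡-Reasoning
    pointwise : ∀ z → ∇ (χ w) w z ≡ + b2n (adj H w z)
    pointwise z with adj H w z in wz
    ... | false = refl
    ... | true rewrite δ-diag w | δ-off (adj⇒≢ wz ∘ sym) = refl

  Δχ-off : ∀ w y → y ≢ w → Δ (χ w) y ≡ ℤ.- + b2n (adj H w y)
  Δχ-off w y y≢w = begin
    Δ (χ w) y    ≡⟨ Σℤ-single (∇ (χ w) y) w off ⟩
    ∇ (χ w) y w  ≡⟨ at-w ⟩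
    ℤ.- + b2n (adj H w y) ∎
    where
    open ≡-Reasoning
    off : ∀ z → z ≢ w → ∇ (χ w) y z ≡ + 0
    off z z≢w with adj H y z
    ... | false = refl
    ... | true rewrite δ-off y≢w | δ-off z≢w = refl
    at-w : ∇ (χ w) y w ≡ ℤ.- + b2n (adj H w y)
    at-w rewrite adjSym H y w | δ-off y≢w | δ-diag w with adj H w y
    ... | false = refl
    ... | true  = refl

  fire-self : ∀ w X → fire H w X w ≡ X w ℤ.- + valence H w
  fire-self w X with w ≟ w
  ... | yes _  = refl
  ... | no w≢w = ⊥-elim (w≢w refl)

  fire-other : ∀ w X y → y ≢ w → fire H w X y ≡ X y ℤ.+ + b2n (adj H w y)
  fire-other w X y y≢w with y ≟ w
  ... | yes y≡w = ⊥-elim (y≢w y≡w)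
  ... | no _    = refl

  fire≡-Δχ : ∀ w X y → fire H w X y ≡ X y ℤ.- Δ (χ w) y
  fire≡-Δχ w X y = by-cases (y ≟ w)
    where
    by-cases : Dec (y ≡ w) → fire H w X y ≡ X y ℤ.- Δ (χ w) y
    by-cases (yes y≡w) rewrite y≡w = trans (fire-self w X) (cong (λ s → X w ℤ.- s) (sym (Δχ-diag w)))
    by-cases (no y≢w)  = trans (fire-other w X y y≢w)
      (cong (λ s → X y ℤ.+ s) (sym (trans (cong ℤ.-_ (Δχ-off w y y≢w)) (ℤP.neg-involutive _))))

  Fires : (Fin n → ℤ) → Divisor n → Divisor n → Set
  Fires f X Y = ∀ y → Y y ≡ X y ℤ.- Δ f y

  fires-nothing : ∀ X → Fires (λ _ → + 0) X X
  fires-nothing X y = sym (trans (cong (λ s → X y ℤ.- s) (Δ-0 y)) (ℤP.+-identityʳ (X y)))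

  fires-trans : ∀ {f g X Y Z} → Fires f X Y → Fires g Y Z → Fires (λ z → f z ℤ.+ g z) X Z
  fires-trans {f} {g} {X} {Y} {Z} X→Y Y→Z y = begin
    Z y                                ≡⟨ Y→Z y ⟩
    Y y ℤ.- Δ g y                      ≡⟨ cong (ℤ._- Δ g y) (X→Y y) ⟩
    (X y ℤ.- Δ f y) ℤ.- Δ g y          ≡⟨ solve 3 (λ x a b → (x :- a) :- b := x :- (a :+ b)) refl (X y) (Δ f y) (Δ g y) ⟩
    X y ℤ.- (Δ f y ℤ.+ Δ g y)          ≡⟨ cong (λ s → X y ℤ.- s) (Δ-+ f g y) ⟨
    X y ℤ.- Δ (λ z → f z ℤ.+ g z) y    ∎
    where open ≡-Reasoning

  step⇒fires : ∀ {X Y} → SymClosure (FiringStep H) X Y → Σ (Fin n → ℤ) λ f → Fires f X Y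
  step⇒fires {X} {Y} (fwd (w , Y≡)) = χ w , λ y → trans (Y≡ y) (fire≡-Δχ w X y)
  step⇒fires {X} {Y} (bwd (w , X≡)) = (λ z → ℤ.- χ w z) , λ y → begin
    Y y                                ≡⟨ solve 2 (λ b d → b := (b :- d) :+ d) refl (Y y) (Δ (χ w) y) ⟩
    (Y y ℤ.- Δ (χ w) y) ℤ.+ Δ (χ w) y  ≡⟨ cong (ℤ._+ Δ (χ w) y) (trans (X≡ y) (fire≡-Δχ w Y y)) ⟨
    X y ℤ.+ Δ (χ w) y                  ≡⟨ cong (λ s → X y ℤ.+ s) (ℤP.neg-involutive (Δ (χ w) y)) ⟨
    X y ℤ.- ℤ.- Δ (χ w) y              ≡⟨ cong (λ s → X y ℤ.- s) (Δ-neg (χ w) y) ⟨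
    X y ℤ.- Δ (λ z → ℤ.- χ w z) y      ∎
    where open ≡-Reasoning

  equiv⇒fires : ∀ {X Y} → Equiv H X Y → Σ (Fin n → ℤ) λ f → Fires f X Y
  equiv⇒fires {X} ε = (λ _ → + 0) , fires-nothing X
  equiv⇒fires {X} (step ◅ steps) with step⇒fires step | equiv⇒fires steps
  ... | f , X→Y | g , Y→Z = (λ z → f z ℤ.+ g z) , fires-trans {f} {g} {X} X→Y Y→Z

  deg-fires : ∀ {f X Y} → Fires f X Y → Σℤ Y ≡ Σℤ X
  deg-fires {f} {X} {Y} X→Y = begin
    Σℤ Y                                  ≡⟨ ΣZ.sum-cong-≗ X→Y ⟩
    Σℤ (λ y → X y ℤ.+ ℤ.- Δ f y)          ≡⟨ ΣZ.∑-distrib-+ X (λ y → ℤ.- Δ f y) ⟩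
    Σℤ X ℤ.+ Σℤ (λ y → ℤ.- Δ f y)         ≡⟨ cong (λ s → Σℤ X ℤ.+ s) (trans (Σℤ-neg (Δ f)) (cong ℤ.-_ (ΣΔ≡0 f))) ⟩
    Σℤ X ℤ.+ + 0                          ≡⟨ ℤP.+-identityʳ (Σℤ X) ⟩
    Σℤ X                                  ∎
    where open ≡-Reasoning

  FiringPositiveRank : Divisor n → Set
  FiringPositiveRank D = ∀ v → Σ (Fin n → ℤ) λ f → ∀ y → + 0 ℤ.≤ D y ℤ.- χ v y ℤ.- Δ f y

  positiveRank⇒firing : ∀ {D} → PositiveRank H D → FiringPositiveRank D
  positiveRank⇒firing {D} pr v with pr v
  ... | E , E≥0 , D-v~E with equiv⇒fires D-v~E
  ...   | f , fires = f , λ y → subst (+ 0 ℤ.≤_) (trans (fires y) (cong (ℤ._- Δ f y) (minusVertex≡ D v y))) (E≥0 y)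

  firingPositiveRank-fires : ∀ {g D D′} → Fires g D D′ → FiringPositiveRank D → FiringPositiveRank D′
  firingPositiveRank-fires {g} {D} {D′} D→D′ pr v with pr v
  ... | f , reach = (λ z → f z ℤ.- g z) , λ y → subst (+ 0 ℤ.≤_) (same y) (reach y)
    where
    same : ∀ y → D y ℤ.- χ v y ℤ.- Δ f y ≡ D′ y ℤ.- χ v y ℤ.- Δ (λ z → f z ℤ.- g z) y
    same y = begin
      D y ℤ.- χ v y ℤ.- Δ f y                          ≡⟨ solve 4 (λ d c a b → (d :- c) :- a := ((d :- b) :- c) :- (a :- b)) refl (D y) (χ v y) (Δ f y) (Δ g y) ⟩
      (D y ℤ.- Δ g y) ℤ.- χ v y ℤ.- (Δ f y ℤ.- Δ g y)  ≡⟨ cong₂ (λ a b → a ℤ.- χ v y ℤ.- b) (sym (D→D′ y)) (sym (Δ-sub f g y)) ⟩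
      D′ y ℤ.- χ v y ℤ.- Δ (λ z → f z ℤ.- g z) y       ∎
      where open ≡-Reasoning

  effective-representative : Fin n → ∀ {D} → FiringPositiveRank D →
                             Σ (Fin n → ℕ) λ D′ → (+ Σℕ D′ ≡ Σℤ D) × FiringPositiveRank (+_ ∘ D′)
  effective-representative v₀ {D} pr with pr v₀
  ... | g , reach = D′ , degree , firingPositiveRank-fires {g} {D} D→D′ pr
    where
    D′ : Fin n → ℕ
    D′ y = ℤ.∣ D y ℤ.- Δ g y ∣
    nonneg : ∀ y → + 0 ℤ.≤ D y ℤ.- Δ g y
    nonneg y = ℤP.≤-trans (reach y) (ℤP.≤-trans
      (ℤP.≤-reflexive (solve 3 (λ d c a → (d :- c) :- a := (d :- a) :- c) refl (D y) (χ v₀ y) (Δ g y)))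
      (ℤP.i-j≤i (D y ℤ.- Δ g y) (χ v₀ y)))
    D→D′ : Fires g D (+_ ∘ D′)
    D→D′ y = ℤP.0≤i⇒+∣i∣≡i (nonneg y)
    degree : + Σℕ D′ ≡ Σℤ D
    degree = trans (sym (Σℤ-fromℕ D′)) (deg-fires {g} {D} D→D′)

  -- Dhar's burning argument

  cut≤ΣΔ : ∀ f T → (∀ y z → lookup T y ≡ true → lookup T z ≡ false → f z ℤ.< f y) →
           + cutSize H T ℤ.≤ Σℤ (restrict T (Δ f))
  cut≤ΣΔ f T T-above = begin
    + cutSize H T                                  ≡⟨ cong +_ (cutSize≡Σ T) ⟩
    + Σℕ (λ y → Σℕ (crosses T y))                  ≡⟨ Σℤ-fromℕ (λ y → Σℕ (crosses T y)) ⟨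
    Σℤ (λ y → + Σℕ (crosses T y))                  ≡⟨ ΣZ.sum-cong-≗ (λ y → Σℤ-fromℕ (crosses T y)) ⟨
    Σℤ (λ y → Σℤ (λ z → + crosses T y z))          ≤⟨ Σℤ-mono-≤ (λ y → Σℤ-mono-≤ (crosses≤leaving y)) ⟩
    Σℤ (λ y → Σℤ (leaving y))                      ≡⟨ ℤP.+-identityˡ _ ⟨
    + 0 ℤ.+ Σℤ (λ y → Σℤ (leaving y))              ≡⟨ cong (ℤ._+ Σℤ (λ y → Σℤ (leaving y))) (Σ²-antisym inner inner-antisym) ⟨
    Σℤ (λ y → Σℤ (inner y)) ℤ.+ Σℤ (λ y → Σℤ (leaving y))  ≡⟨ ΣZ.∑-distrib-+ (λ y → Σℤ (inner y)) (λ y → Σℤ (leaving y)) ⟨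
    Σℤ (λ y → Σℤ (inner y) ℤ.+ Σℤ (leaving y))     ≡⟨ ΣZ.sum-cong-≗ split ⟩
    Σℤ (restrict T (Δ f))                          ∎
    where
    open ℤP.≤-Reasoning
    inner leaving : Fin n → Fin n → ℤ
    inner   y z = if lookup T y ∧ lookup T z then ∇ f y z else + 0
    leaving y z = if lookup T y ∧ not (lookup T z) then ∇ f y z else + 0

    inner-antisym : ∀ y z → inner z y ≡ ℤ.- inner y z
    inner-antisym y z with lookup T y | lookup T z
    ... | true  | true  = ∇-antisym f y z
    ... | true  | false = refl
    ... | false | true  = refl
    ... | false | false = refl

    crosses≤leaving : ∀ y z → + crosses T y z ℤ.≤ leaving y z
    crosses≤leaving y z with lookup T y in y∈T | lookup T z in z∉T
    ... | true  | true  = ℤP.≤-refl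
    ... | false | _     = ℤP.≤-refl
    ... | true  | false with adj H y z
    ...   | true  = <⇒1≤- (T-above y z y∈T z∉T)
    ...   | false = ℤP.≤-refl

    split : ∀ y → Σℤ (inner y) ℤ.+ Σℤ (leaving y) ≡ (if lookup T y then Δ f y else + 0)
    split y = begin-equality
      Σℤ (inner y) ℤ.+ Σℤ (leaving y)                      ≡⟨ ΣZ.∑-distrib-+ (inner y) (leaving y) ⟨
      Σℤ (λ z → inner y z ℤ.+ leaving y z)                 ≡⟨ ΣZ.sum-cong-≗ (λ z → if-∧-split (lookup T y) (lookup T z) (∇ f y z)) ⟩
      Σℤ (λ z → if lookup T y then ∇ f y z else + 0)       ≡⟨ Σℤ-if (lookup T y) (∇ f y) ⟩
      (if lookup T y then Δ f y else + 0)                  ∎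

  higher-neighbour-or-local-max : ∀ (f : Fin n → ℤ) w → (Σ (Fin n) λ z → adj H w z ≡ true × f w ℤ.< f z) ⊎
                                          (∀ z → adj H w z ≡ true → f z ℤ.≤ f w)
  higher-neighbour-or-local-max f w with any? (λ z → (adj H w z Bool.≟ true) ×-dec (f w ℤP.<? f z))
  ... | yes higher = inj₁ higher
  ... | no  none   = inj₂ (λ z wz → ℤP.≮⇒≥ (λ fw<fz → none (z , wz , fw<fz)))

  local-max-Δ : ∀ (f : Fin n → ℤ) w u → adj H w u ≡ true → (∀ z → adj H w z ≡ true → f z ℤ.≤ f w) → f w ℤ.- f u ℤ.≤ Δ f w
  local-max-Δ f w u wu max = subst (ℤ._≤ Δ f w) at-u (term≤Σℤ (∇ f w) ∇≥0 u)
    where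
    ∇≥0 : ∀ z → + 0 ℤ.≤ ∇ f w z
    ∇≥0 z with adj H w z in wz
    ... | false = ℤP.≤-refl
    ... | true  = ℤP.i≤j⇒0≤j-i (max z wz)
    at-u : ∇ f w u ≡ f w ℤ.- f u
    at-u rewrite wu = refl

  Heavy : (Fin n → ℕ) → Fin n → Set
  Heavy D u = valence H u ≤ D u

  SmallCutsIsolate : Set
  SmallCutsIsolate = ∀ T {z p q} → lookup T z ≡ true → lookup T p ≡ false → lookup T q ≡ false → p ≢ q →
                     2 + cutSize H T ≤ n → ∀ u → lookup T u ≡ true → u ≡ z

  record ObstructingPair (D : Fin n → ℕ) : Set where
    field
      {v x}    : Fin n
      Dv≡0     : D v ≡ 0
      Dx≡0     : D x ≡ 0
      adjacent : adj H v x ≡ true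
      far      : ∀ u → Heavy D u → adj H u v ≡ false × adj H u x ≡ false

  module _ (isolate : SmallCutsIsolate) (D : Fin n → ℕ) (small : 2 + Σℕ D ≤ n)
           {v} (f : Fin n → ℤ) (reach : ∀ y → + 0 ℤ.≤ + D y ℤ.- χ v y ℤ.- Δ f y) where

    Δ≤D-χ : ∀ y → Δ f y ℤ.≤ + D y ℤ.- χ v y
    Δ≤D-χ y = ℤP.0≤i-j⇒j≤i (reach y)

    -- Chips leave {f > t} across all of its cut, so the cut is at most deg D and the set is a
    -- singleton {z}; then z gives away valence z chips and keeps a nonnegative number.
    level-set-heavy : ∀ t {z p q} → t ℤ.< f z → f p ℤ.≤ t → f q ℤ.≤ t → p ≢ q → Heavy D z
    level-set-heavy t {z} t<fz fp≤t fq≤t p≢q = ℤP.drop‿+≤+ (begin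
      + valence H z                    ≡⟨ cong +_ (cutSize-singleton T z z∈T isolated) ⟨
      + cutSize H T                    ≤⟨ cut≤ΣD ⟩
      Σℤ (restrict T (+_ ∘ D))         ≡⟨ Σrestrict-singleton T z (+_ ∘ D) isolated z∈T ⟩
      + D z                            ∎)
      where
      open ℤP.≤-Reasoning
      T = above f t
      z∈T = ∈above⁺ f t t<fz
      cut≤ΣD : + cutSize H T ℤ.≤ Σℤ (restrict T (+_ ∘ D))
      cut≤ΣD = ℤP.≤-trans (cut≤ΣΔ f T (λ y w y∈T w∉T → ℤP.≤-<-trans (∉above⁻ f t w∉T) (∈above⁻ f t y∈T)))
                          (Σℤ-mono-≤ (restrict-mono-≤ T (λ y → ℤP.≤-trans (Δ≤D-χ y) (ℤP.i-j≤i (+ D y) (χ v y)))))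
      isolated : ∀ u → lookup T u ≡ true → u ≡ z
      isolated = isolate T z∈T (∉above⁺ f t fp≤t) (∉above⁺ f t fq≤t) p≢q
                   (ℕP.≤-trans (s≤s (s≤s (ℤP.drop‿+≤+ (ℤP.≤-trans cut≤ΣD (Σrestrict≤Σ T D))))) small)

    higher-neighbour : ∀ w u → adj H w u ≡ true → (f u ℤ.≤ f w → + D w ℤ.- χ v w ℤ.< f w ℤ.- f u) →
                       Σ (Fin n) λ z → adj H w z ≡ true × f w ℤ.< f z
    higher-neighbour w u wu gap with higher-neighbour-or-local-max f w
    ... | inj₁ higher = higher
    ... | inj₂ w-max  = ⊥-elim (ℤP.<⇒≱ (gap (w-max u wu)) (ℤP.≤-trans (local-max-Δ f w u wu w-max) (Δ≤D-χ w)))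

    lowest : ∀ {z} → adj H v z ≡ true → f v ℤ.< f z → (∀ u → Heavy D u → adj H u v ≡ false) →
             ∀ y → v ≢ y → f v ℤ.< f y
    lowest {z} vz fv<fz far y v≢y with f v ℤP.<? f y
    ... | yes fv<fy = fv<fy
    ... | no  fv≮fy = ⊥-elim (adj-both vz (far z (level-set-heavy (f v) fv<fz ℤP.≤-refl (ℤP.≮⇒≥ fv≮fy) v≢y)))

    -- D − (v) lacks a chip at v, so v has a higher neighbour z, and {f > f v} = {z} forces v to be
    -- the strict minimum of f; then chip-free x lies above v, so it has a higher neighbour z′ and
    -- {f > f x} = {z′}.  Both z and z′ are heavy, against the choice of v and x.
    obstructed-script : ∀ {x} → D v ≡ 0 → D x ≡ 0 → adj H v x ≡ true →
                        (∀ u → Heavy D u → adj H u v ≡ false × adj H u x ≡ false) → ⊥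
    obstructed-script {x} Dv≡0 Dx≡0 vx far with higher-neighbour v x vx v-gap
      where
      v-gap : f x ℤ.≤ f v → + D v ℤ.- χ v v ℤ.< f v ℤ.- f x
      v-gap fx≤fv rewrite Dv≡0 | δ-diag v = ℤP.<-≤-trans ℤ.-<+ (ℤP.i≤j⇒0≤j-i fx≤fv)
    ... | z , vz , fv<fz = x-climbs (lowest vz fv<fz (λ u → proj₁ ∘ far u) x (adj⇒≢ vx))
      where
      x-climbs : f v ℤ.< f x → ⊥
      x-climbs fv<fx with higher-neighbour x v (trans (adjSym H x v) vx) x-gap
        where
        x-gap : f v ℤ.≤ f x → + D x ℤ.- χ v x ℤ.< f x ℤ.- f v
        x-gap _ rewrite Dx≡0 | δ-off (adj⇒≢ vx ∘ sym) = ℤP.suc[i]≤j⇒i<j (<⇒1≤- fv<fx)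
      ... | z′ , xz′ , fx<fz′ =
        adj-both xz′ (proj₂ (far z′ (level-set-heavy (f x) fx<fz′ (ℤP.<⇒≤ fv<fx) ℤP.≤-refl (adj⇒≢ vx))))

  obstructed : SmallCutsIsolate → ∀ D → 2 + Σℕ D ≤ n → ObstructingPair D → ¬ FiringPositiveRank (+_ ∘ D)
  obstructed isolate D small pair positive =
    obstructed-script isolate D small (proj₁ (positive v)) (proj₂ (positive v)) Dv≡0 Dx≡0 adjacent far
    where open ObstructingPair pair

  VertexCover : Subset n → Set
  VertexCover S = ∀ u w → lookup S u ≡ false → lookup S w ≡ false → adj H u w ≡ false

  module _ {S : Subset n} (cover : VertexCover S) where

    indicator-positiveRank : (∀ u → lookup S u ≡ false → 1 ≤ valence H u) → PositiveRank H (indicator S)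
    indicator-positiveRank nonisolated v with lookup S v in v∈S
    ... | true  = minusVertex (indicator S) v , D-v≥0 , ε
      where
      D-v≥0 : Effective (minusVertex (indicator S) v)
      D-v≥0 y with y ≟ v
      ... | yes refl rewrite v∈S = ℤP.≤-refl
      ... | no _     = +≤+ z≤n
    ... | false = E , E≥0 , (bwd (v , E-fires-to-D-v) ◅ ε)
      where
      E : Divisor n
      E y = minusVertex (indicator S) v y ℤ.+ Δ (χ v) y
      E-fires-to-D-v : ∀ y → minusVertex (indicator S) v y ≡ fire H v E y
      E-fires-to-D-v y = sym (trans (fire≡-Δχ v E y) (solve 2 (λ a b → (a :+ b) :- b := a) refl (minusVertex (indicator S) v y) (Δ (χ v) y)))
      E≥0 : Effective E
      E≥0 y = subst (λ s → + 0 ℤ.≤ s ℤ.+ Δ (χ v) y) (sym (minusVertex≡ (indicator S) v y)) (by-cases (y ≟ v))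
        where
        by-cases : Dec (y ≡ v) → + 0 ℤ.≤ indicator S y ℤ.- χ v y ℤ.+ Δ (χ v) y
        by-cases (yes y≡v) rewrite y≡v | Δχ-diag v | v∈S | δ-diag v with valence H v | nonisolated v v∈S
        ... | suc _ | _ = +≤+ z≤n
        by-cases (no y≢v) rewrite Δχ-off v y y≢v | δ-off y≢v with adj H v y in vy
        ... | false = ℤP.≤-trans (+≤+ z≤n) (ℤP.≤-reflexive (sym (ℤP.+-identityʳ _)))
        ... | true with lookup S y in y∈S
        ...   | true  = ℤP.≤-refl
        ...   | false with trans (sym vy) (cover v y v∈S y∈S)
        ...     | ()

    misses⇒outside : ∀ {E} → ¬ Nonempty (E ∩ S) → ∀ u → u ∈ E → lookup S u ≡ false
    misses⇒outside misses u u∈E with lookup S u in u∈S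
    ... | false = refl
    ... | true  = ⊥-elim (misses (u , x∈p∩q⁺ (u∈E , lookup⇒[]= u S u∈S)))

    missed-egg-singleton : ∀ {E} → IsEgg H E → ¬ Nonempty (E ∩ S) → ∀ {v} → v ∈ E → E ⊆ ⁅ v ⁆
    missed-egg-singleton (_ , connected) misses {v} v∈E {u} u∈E with connected v u v∈E u∈E
    ... | ε = x∈⁅x⁆ v
    ... | (x∈E , y∈E , xy) ◅ _ with trans (sym xy) (cover _ _ (misses⇒outside misses _ x∈E) (misses⇒outside misses _ y∈E))
    ...   | ()

    module _ {k} (|S|≤k : ∣ S ∣ ≤ k) (1≤k : 1 ≤ k) (valence≤k : ∀ u → lookup S u ≡ false → valence H u ≤ k)
             (Sc : List.List (Subset n)) (scramble : IsScramble H Sc) where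

      order≤-from-missed-egg : ∀ {E v} → E ∈ₗ Sc → ¬ Nonempty (E ∩ S) → v ∈ E → OrderAtMost H Sc k
      order≤-from-missed-egg {E} {v} E∈Sc misses v∈E with Any.any? (λ E′ → E′ ⊆? ∁ ⁅ v ⁆) Sc
      ... | yes E′⊆∁v with find E′⊆∁v
      ...   | E′ , E′∈Sc , E′⊆ = inj₂ (⁅ v ⁆ , ((E , E∈Sc , missed-egg-singleton (scramble E E∈Sc) misses v∈E) , (E′ , E′∈Sc , E′⊆)) ,
                                       subst (_≤ k) (sym (cutSize-⁅⁆ v)) (valence≤k v (misses⇒outside misses v v∈E)))
      order≤-from-missed-egg {E} {v} E∈Sc misses v∈E | no none = inj₁ (⁅ v ⁆ , v-hits , subst (_≤ k) (sym (∣⁅x⁆∣≡1 v)) 1≤k)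
        where
        v-hits : Hits Sc ⁅ v ⁆
        v-hits E′ E′∈Sc with v ∈? E′
        ... | yes v∈E′ = v , x∈p∩q⁺ (v∈E′ , x∈⁅x⁆ v)
        ... | no  v∉E′ = ⊥-elim (none (lose E′∈Sc (∉⇒⊆∁⁅⁆ v∉E′)))

      scramble-order≤ : OrderAtMost H Sc k
      scramble-order≤ with all? (λ E → nonempty? (E ∩ S)) Sc
      ... | yes all-hit = inj₁ (S , (λ E E∈Sc → lookupAll all-hit E∈Sc) , |S|≤k)
      ... | no  some-miss with find (¬All⇒Any¬ (λ E → nonempty? (E ∩ S)) Sc some-miss)
      ...   | E , E∈Sc , misses = order≤-from-missed-egg E∈Sc misses (proj₂ (proj₁ (scramble E E∈Sc)))

-- The cone

module Cone {m} (G : SimpleGraph m) where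

  N : ℕ
  N = m + m

  Ĝ : SimpleGraph N
  Ĝ = cone G m

  base apex : Fin m → Fin N
  base i = i ↑ˡ m
  apex j = m ↑ʳ j

  data ConeVertex : Fin N → Set where
    is-base : ∀ i → ConeVertex (base i)
    is-apex : ∀ j → ConeVertex (apex j)

  vertex : ∀ x → ConeVertex x
  vertex x with splitAt m x in eq
  ... | inj₁ i = subst ConeVertex (splitAt⁻¹-↑ˡ eq) (is-base i)
  ... | inj₂ j = subst ConeVertex (splitAt⁻¹-↑ʳ eq) (is-apex j)

  adj-base-base : ∀ i i′ → adj Ĝ (base i) (base i′) ≡ adj G i i′
  adj-base-base i i′ rewrite splitAt-↑ˡ m i m | splitAt-↑ˡ m i′ m = refl

  adj-base-apex : ∀ i j → adj Ĝ (base i) (apex j) ≡ true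
  adj-base-apex i j rewrite splitAt-↑ˡ m i m | splitAt-↑ʳ m m j = refl

  adj-apex-base : ∀ j i → adj Ĝ (apex j) (base i) ≡ true
  adj-apex-base j i rewrite splitAt-↑ʳ m m j | splitAt-↑ˡ m i m = refl

  adj-apex-apex : ∀ j j′ → adj Ĝ (apex j) (apex j′) ≡ not ⌊ j ≟ j′ ⌋
  adj-apex-apex j j′ rewrite splitAt-↑ʳ m m j | splitAt-↑ʳ m m j′ = refl

  base-injective : ∀ {i i′} → base i ≡ base i′ → i ≡ i′
  base-injective = ↑ˡ-injective m _ _

  adj-apex : ∀ j x → x ≢ apex j → adj Ĝ (apex j) x ≡ true
  adj-apex j x x≢j with vertex x
  ... | is-base i  = adj-apex-base j i
  ... | is-apex j′ rewrite adj-apex-apex j j′ with j ≟ j′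
  ...   | yes refl = ⊥-elim (x≢j refl)
  ...   | no _     = refl

  adj-to-apex : ∀ j x → x ≢ apex j → adj Ĝ x (apex j) ≡ true
  adj-to-apex j x x≢j = trans (adjSym Ĝ x j′) (adj-apex j x x≢j)
    where j′ = apex j

  degree : Fin m → ℕ
  degree i = Σℕ (b2n ∘ adj G i)

  valence-base : ∀ i → valence Ĝ (base i) ≡ degree i + m
  valence-base i = begin
    valence Ĝ (base i)                                   ≡⟨ valence≡Σ Ĝ (base i) ⟩
    Σℕ (b2n ∘ adj Ĝ (base i))                            ≡⟨ Σℕ-splitAt m (b2n ∘ adj Ĝ (base i)) ⟩
    Σℕ (b2n ∘ adj Ĝ (base i) ∘ base) + Σℕ (b2n ∘ adj Ĝ (base i) ∘ apex)
        ≡⟨ cong₂ _+_ (ΣN.sum-cong-≗ (cong b2n ∘ adj-base-base i)) (trans (ΣN.sum-cong-≗ (cong b2n ∘ adj-base-apex i)) (Σℕ-ones m)) ⟩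
    degree i + m                                         ∎
    where open ≡-Reasoning

  valence-apex : ∀ j → 1 + valence Ĝ (apex j) ≡ N
  valence-apex j = begin
    1 + valence Ĝ (apex j)                          ≡⟨ cong₂ _+_ (sym (Σℕ-δ (apex j))) (valence≡Σ Ĝ (apex j)) ⟩
    Σℕ (δ (apex j)) + Σℕ (b2n ∘ adj Ĝ (apex j))     ≡⟨ ΣN.∑-distrib-+ (δ (apex j)) (b2n ∘ adj Ĝ (apex j)) ⟨
    Σℕ (λ x → δ (apex j) x + b2n (adj Ĝ (apex j) x)) ≡⟨ ΣN.sum-cong-≗ one ⟩
    Σℕ {N} (λ _ → 1)                                  ≡⟨ Σℕ-ones N ⟩
    N                                               ∎
    where
    open ≡-Reasoning
    one : ∀ x → δ (apex j) x + b2n (adj Ĝ (apex j) x) ≡ 1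
    one x with x ≟ apex j
    ... | yes refl = cong (λ b → 1 + b2n b) (irrefl Ĝ (apex j))
    ... | no x≢j   = cong b2n (adj-apex j x x≢j)

  m≤valence : 1 ≤ m → ∀ x → m ≤ valence Ĝ x
  m≤valence 1≤m x with vertex x
  ... | is-base i = subst (m ≤_) (sym (valence-base i)) (ℕP.m≤n+m m (degree i))
  ... | is-apex j = ℕP.+-cancelˡ-≤ 1 m _ (subst (1 + m ≤_) (sym (valence-apex j)) (ℕP.+-monoˡ-≤ m 1≤m))

  Σ-over-apexes≤ : ∀ (f : Fin N → ℕ) → (∀ j → f (apex j) ≡ 1) → m ≤ Σℕ f
  Σ-over-apexes≤ f one = begin
    m                            ≡⟨ trans (sym (Σℕ-ones m)) (ΣN.sum-cong-≗ (sym ∘ one)) ⟩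
    Σℕ (f ∘ apex)                ≤⟨ ℕP.m≤n+m _ (Σℕ (f ∘ base)) ⟩
    Σℕ (f ∘ base) + Σℕ (f ∘ apex) ≡⟨ Σℕ-splitAt m f ⟨
    Σℕ f                         ∎
    where open ℕP.≤-Reasoning

  cut-two-bases-inside : ∀ T {i i′} → i ≢ i′ → lookup T (base i) ≡ true → lookup T (base i′) ≡ true →
                         (∀ j → lookup T (apex j) ≡ false) → N ≤ cutSize Ĝ T
  cut-two-bases-inside T {i} {i′} i≢i′ i∈T i′∈T apexes-out =
    ℕP.≤-trans (ℕP.+-mono-≤ (Σ-over-apexes≤ _ (row i∈T)) (Σ-over-apexes≤ _ (row i′∈T))) (two-rows≤cut Ĝ T (i≢i′ ∘ base-injective))
    where
    row : ∀ {i} → lookup T (base i) ≡ true → ∀ j → crosses Ĝ T (base i) (apex j) ≡ 1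
    row {i} i∈T j rewrite i∈T | apexes-out j | adj-base-apex i j = refl

  cut-two-bases-outside : ∀ T {i i′} → i ≢ i′ → lookup T (base i) ≡ false → lookup T (base i′) ≡ false →
                          (∀ j → lookup T (apex j) ≡ true) → N ≤ cutSize Ĝ T
  cut-two-bases-outside T {i} {i′} i≢i′ i∉T i′∉T apexes-in =
    ℕP.≤-trans (ℕP.+-mono-≤ (Σ-over-apexes≤ _ (column i∉T)) (Σ-over-apexes≤ _ (column i′∉T))) (two-columns≤cut Ĝ T (i≢i′ ∘ base-injective))
    where
    column : ∀ {i} → lookup T (base i) ≡ false → ∀ j → crosses Ĝ T (apex j) (base i) ≡ 1
    column {i} i∉T j rewrite apexes-in j | i∉T | adj-apex-base j i = refl

  cut-mixed-apexes : ∀ T {j j′} → lookup T (apex j) ≡ true → lookup T (apex j′) ≡ false → N ≤ 1 + cutSize Ĝ T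
  cut-mixed-apexes T {j} {j′} j∈T j′∉T = cut-hub Ĝ T j∈T j′∉T
    (λ v v∉T → adj-apex j v (member≢nonmember T j∈T v∉T ∘ sym))
    (λ u u∈T → adj-to-apex j′ u (member≢nonmember T u∈T j′∉T))

  data ApexSplit (T : Subset N) : Set where
    mixed   : ∀ {j j′} → lookup T (apex j) ≡ true → lookup T (apex j′) ≡ false → ApexSplit T
    all-in  : (∀ j → lookup T (apex j) ≡ true) → ApexSplit T
    all-out : (∀ j → lookup T (apex j) ≡ false) → ApexSplit T

  apex-split : ∀ T → ApexSplit T
  apex-split T with any? (λ j → lookup T (apex j) Bool.≟ true) | any? (λ j → lookup T (apex j) Bool.≟ false)
  ... | yes (_ , j∈T) | yes (_ , j′∉T) = mixed j∈T j′∉T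
  ... | _             | no  none-out   = all-in (λ j → Bool.¬-not (λ j∉T → none-out (j , j∉T)))
  ... | no  none-in   | _              = all-out (λ j → Bool.¬-not (λ j∈T → none-in (j , j∈T)))

  cone-small-cuts-isolate : SmallCutsIsolate Ĝ
  cone-small-cuts-isolate T {z} {p} {q} z∈T p∉T q∉T p≢q small u u∈T with apex-split T
  ... | mixed j∈T j′∉T = ⊥-elim (ℕP.1+n≰n (ℕP.≤-trans small (cut-mixed-apexes T j∈T j′∉T)))
  ... | all-in apexes-in = ⊥-elim (two-outside (vertex p) (vertex q) p∉T q∉T p≢q)
    where
    two-outside : ∀ {p q} → ConeVertex p → ConeVertex q → lookup T p ≡ false → lookup T q ≡ false → p ≢ q → ⊥
    two-outside (is-apex j) _ p∉T _ _ = member≢nonmember T (apexes-in j) p∉T refl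
    two-outside _ (is-apex j) _ q∉T _ = member≢nonmember T (apexes-in j) q∉T refl
    two-outside (is-base i) (is-base i′) i∉T i′∉T b≢b′ =
      ℕP.1+n≰n (ℕP.≤-trans (ℕP.≤-trans small (cut-two-bases-outside T (b≢b′ ∘ cong base) i∉T i′∉T apexes-in)) (ℕP.n≤1+n _))
  ... | all-out apexes-out = two-inside (vertex u) (vertex z) u∈T z∈T
    where
    two-inside : ∀ {u z} → ConeVertex u → ConeVertex z → lookup T u ≡ true → lookup T z ≡ true → u ≡ z
    two-inside (is-apex j) _ u∈T _ = ⊥-elim (member≢nonmember T u∈T (apexes-out j) refl)
    two-inside _ (is-apex j) _ z∈T = ⊥-elim (member≢nonmember T z∈T (apexes-out j) refl)
    two-inside (is-base i) (is-base i′) i∈T i′∈T with i ≟ i′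
    ... | yes refl = refl
    ... | no  i≢i′ = ⊥-elim (ℕP.1+n≰n (ℕP.≤-trans (ℕP.≤-trans small (cut-two-bases-inside T i≢i′ i∈T i′∈T apexes-out)) (ℕP.n≤1+n _)))

  independent-count : ∀ {a} → (∀ S → Independent G S → ∣ S ∣ ≤ a) → (s : Fin m → Bool) →
                      (∀ i i′ → s i ≡ true → s i′ ≡ true → adj G i i′ ≡ false) → Σℕ (b2n ∘ s) ≤ a
  independent-count α-bound s independent = subst (_≤ _) card (α-bound (tabulate s) independent′)
    where
    s-tab : ∀ {i} → i ∈ tabulate s → s i ≡ true
    s-tab {i} i∈ = trans (sym (lookup∘tabulate s i)) ([]=⇒lookup i∈)
    independent′ : Independent G (tabulate s)
    independent′ i i′ i∈ i′∈ = independent i i′ (s-tab i∈) (s-tab i′∈)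
    card : ∣ tabulate s ∣ ≡ Σℕ (b2n ∘ s)
    card = trans (∣p∣≡Σℕ (tabulate s)) (ΣN.sum-cong-≗ (cong b2n ∘ lookup∘tabulate s))

  edge-or-independent : (s : Fin m → Bool) →
                        (Σ (Fin m) λ i → Σ (Fin m) λ i′ → s i ≡ true × s i′ ≡ true × adj G i i′ ≡ true) ⊎
                        (∀ i i′ → s i ≡ true → s i′ ≡ true → adj G i i′ ≡ false)
  edge-or-independent s with any? (λ i → any? (λ i′ → (s i Bool.≟ true) ×-dec ((s i′ Bool.≟ true) ×-dec (adj G i i′ Bool.≟ true))))
  ... | yes edge = inj₁ edge
  ... | no  none = inj₂ (λ i i′ si si′ → Bool.¬-not (λ ii′ → none (i , i′ , si , si′ , ii′)))

  -- Effective divisors of degree below 2m − α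

  module _ (1≤m : 1 ≤ m) {a} (α-bound : ∀ S → Independent G S → ∣ S ∣ ≤ a) (1≤a : 1 ≤ a)
           (D : Fin N → ℕ) (deg-small : suc (Σℕ D + a) ≤ N) where

    vanishes : Fin N → Bool
    vanishes y = D y ℕ.≡ᵇ 0

    vanishes⇒0 : ∀ {y} → vanishes y ≡ true → D y ≡ 0
    vanishes⇒0 {y} vy with D y
    ... | zero = refl

    nonvanishing≤D : ∀ y → b2n (not (vanishes y)) ≤ D y
    nonvanishing≤D y with D y
    ... | zero  = z≤n
    ... | suc _ = s≤s z≤n

    zeros : ℕ
    zeros = Σℕ (b2n ∘ vanishes)

    a<zeros : suc a ≤ zeros
    a<zeros = ℕP.+-cancelʳ-≤ (Σℕ D) (suc a) zeros (begin
      suc a + Σℕ D                                  ≡⟨ cong suc (ℕP.+-comm a (Σℕ D)) ⟩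
      suc (Σℕ D + a)                                ≤⟨ deg-small ⟩
      N                                             ≡⟨ trans (sym (Σℕ-ones N)) (ΣN.sum-cong-≗ (λ y → sym (b2n+b2n∘not (vanishes y)))) ⟩
      Σℕ (λ y → b2n (vanishes y) + b2n (not (vanishes y)))  ≡⟨ ΣN.∑-distrib-+ (b2n ∘ vanishes) (b2n ∘ not ∘ vanishes) ⟩
      zeros + Σℕ (b2n ∘ not ∘ vanishes)             ≤⟨ ℕP.+-monoʳ-≤ zeros (Σℕ-mono-≤ nonvanishing≤D) ⟩
      zeros + Σℕ D                                  ∎)
      where open ℕP.≤-Reasoning

    small : 2 + Σℕ D ≤ N
    small = ℕP.≤-trans (s≤s (subst (_≤ Σℕ D + a) (ℕP.+-comm (Σℕ D) 1) (ℕP.+-monoʳ-≤ (Σℕ D) 1≤a))) deg-small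

    apex-light : ∀ j → ¬ Heavy Ĝ D (apex j)
    apex-light j heavy = ℕP.<-irrefl refl (begin-strict
      N                         ≡⟨ valence-apex j ⟨
      1 + valence Ĝ (apex j)    ≤⟨ s≤s (ℕP.≤-trans heavy (term≤Σℕ D (apex j))) ⟩
      1 + Σℕ D                  <⟨ ℕP.n<1+n _ ⟩
      2 + Σℕ D                  ≤⟨ small ⟩
      N                         ∎)
      where open ℕP.≤-Reasoning

    heavy-unique : ∀ {u u′} → Heavy Ĝ D u → Heavy Ĝ D u′ → u ≡ u′
    heavy-unique {u} {u′} heavy heavy′ with u ≟ u′
    ... | yes u≡u′ = u≡u′
    ... | no  u≢u′ = ⊥-elim (ℕP.<-irrefl refl (begin-strict
      N                          ≤⟨ ℕP.+-mono-≤ (m≤valence 1≤m u) (m≤valence 1≤m u′) ⟩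
      valence Ĝ u + valence Ĝ u′ ≤⟨ ℕP.+-mono-≤ heavy heavy′ ⟩
      D u + D u′                 ≤⟨ two-terms≤Σℕ D u≢u′ ⟩
      Σℕ D                       <⟨ ℕP.≤-trans (ℕP.n<1+n _) (ℕP.n≤1+n _) ⟩
      2 + Σℕ D                   ≤⟨ small ⟩
      N                          ∎))
      where open ℕP.≤-Reasoning

    another-zero : ∀ w → Σ (Fin N) λ y → y ≢ w × vanishes y ≡ true
    another-zero w with any? (λ y → ¬? (y ≟ w) ×-dec (vanishes y Bool.≟ true))
    ... | yes found = found
    ... | no  none  = ⊥-elim (ℕP.<-irrefl refl (begin-strict
      1               ≤⟨ 1≤a ⟩
      a               <⟨ a<zeros ⟩
      zeros           ≤⟨ Σℕ-mono-≤ zero≤δ ⟩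
      Σℕ (δ w)        ≡⟨ Σℕ-δ w ⟩
      1               ∎))
      where
      open ℕP.≤-Reasoning
      zero≤δ : ∀ y → b2n (vanishes y) ≤ δ w y
      zero≤δ y with y ≟ w | vanishes y in vy
      ... | yes _  | b     = b2n≤1 b
      ... | no _   | false = z≤n
      ... | no y≢w | true  = ⊥-elim (none (y , y≢w , vy))

    pair-without-heavy : (∀ u → ¬ Heavy Ĝ D u) → ObstructingPair Ĝ D
    pair-without-heavy light with any? (λ j → vanishes (apex j) Bool.≟ true)
    ... | yes (j , j-zero) with another-zero (apex j)
    ...   | y , y≢j , y-zero = record
      { Dv≡0 = vanishes⇒0 j-zero ; Dx≡0 = vanishes⇒0 y-zero ; adjacent = adj-apex j y y≢j
      ; far = λ u heavy → ⊥-elim (light u heavy) }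
    pair-without-heavy light | no apexes-nonzero with edge-or-independent (vanishes ∘ base)
    ... | inj₁ (i , i′ , i-zero , i′-zero , ii′) = record
      { Dv≡0 = vanishes⇒0 i-zero ; Dx≡0 = vanishes⇒0 i′-zero ; adjacent = trans (adj-base-base i i′) ii′
      ; far = λ u heavy → ⊥-elim (light u heavy) }
    ... | inj₂ independent = ⊥-elim (ℕP.<⇒≱ a<zeros (begin
      zeros                                                        ≡⟨ Σℕ-splitAt m (b2n ∘ vanishes) ⟩
      Σℕ (b2n ∘ vanishes ∘ base) + Σℕ (b2n ∘ vanishes ∘ apex)      ≡⟨ cong (λ k → Σℕ (b2n ∘ vanishes ∘ base) + k) apexes-count-0 ⟩
      Σℕ (b2n ∘ vanishes ∘ base) + 0                               ≡⟨ ℕP.+-identityʳ _ ⟩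
      Σℕ (b2n ∘ vanishes ∘ base)                                   ≤⟨ independent-count α-bound (vanishes ∘ base) independent ⟩
      a                                                            ∎))
      where
      open ℕP.≤-Reasoning
      apexes-count-0 : Σℕ (b2n ∘ vanishes ∘ apex) ≡ 0
      apexes-count-0 = trans (ΣN.sum-cong-≗ (λ j → cong b2n (Bool.¬-not (λ j-zero → apexes-nonzero (j , j-zero)))))
                             (ΣN.sum-replicate-zero m)

    module _ (i₀ : Fin m) where

      distant-zero distant-nonzero : Fin m → Bool
      distant-zero    i = not ⌊ i ≟ i₀ ⌋ ∧ not (adj G i₀ i) ∧ vanishes (base i)
      distant-nonzero i = not ⌊ i ≟ i₀ ⌋ ∧ not (adj G i₀ i) ∧ not (vanishes (base i))

      distant-zero⇒ : ∀ {i} → distant-zero i ≡ true → adj G i₀ i ≡ false × vanishes (base i) ≡ true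
      distant-zero⇒ {i} far-i with i ≟ i₀ | adj G i₀ i | vanishes (base i)
      ... | no _ | false | true = refl , refl

      partition : ∀ i → 1 ≡ δ i₀ i + (b2n (adj G i₀ i) + (b2n (distant-zero i) + b2n (distant-nonzero i)))
      partition i with i ≟ i₀ | adj G i₀ i in i₀i | vanishes (base i)
      ... | yes refl | b     | _     = cong (λ c → 1 + (b2n c + 0)) (trans (sym (irrefl G i)) i₀i)
      ... | no _     | true  | _     = refl
      ... | no _     | false | true  = refl
      ... | no _     | false | false = refl

      distant-nonzero≤D : ∀ i → i ≢ i₀ → b2n (distant-nonzero i) ≤ D (base i)
      distant-nonzero≤D i i≢i₀ with i ≟ i₀ | adj G i₀ i
      ... | yes i≡i₀ | _     = ⊥-elim (i≢i₀ i≡i₀)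
      ... | no _     | true  = z≤n
      ... | no _     | false = nonvanishing≤D (base i)

      distant-nonzero-i₀ : distant-nonzero i₀ ≡ false
      distant-nonzero-i₀ with i₀ ≟ i₀
      ... | yes _    = refl
      ... | no i₀≢i₀ = ⊥-elim (i₀≢i₀ refl)

      with-i₀ : Fin m → Bool
      with-i₀ i = ⌊ i ≟ i₀ ⌋ ∨ distant-zero i

      with-i₀-count : ∀ i → b2n (with-i₀ i) ≡ δ i₀ i + b2n (distant-zero i)
      with-i₀-count i with i ≟ i₀
      ... | yes _ = refl
      ... | no _  = refl

      with-i₀-cases : ∀ {i} → with-i₀ i ≡ true → i ≡ i₀ ⊎ distant-zero i ≡ true
      with-i₀-cases {i} wi with i ≟ i₀
      ... | yes i≡i₀ = inj₁ i≡i₀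
      ... | no _     = inj₂ wi

      with-i₀-independent : (∀ i i′ → distant-zero i ≡ true → distant-zero i′ ≡ true → adj G i i′ ≡ false) →
                            ∀ i i′ → with-i₀ i ≡ true → with-i₀ i′ ≡ true → adj G i i′ ≡ false
      with-i₀-independent independent i i′ wi wi′ with with-i₀-cases {i} wi | with-i₀-cases {i′} wi′
      ... | inj₁ refl  | inj₁ refl   = irrefl G i
      ... | inj₁ refl  | inj₂ far-i′ = proj₁ (distant-zero⇒ far-i′)
      ... | inj₂ far-i | inj₁ refl   = trans (adjSym G i i′) (proj₁ (distant-zero⇒ far-i))
      ... | inj₂ far-i | inj₂ far-i′ = independent i i′ far-i far-i′

      -- With S the chip-free and R the other non-neighbours of i₀: m = 1 + deg i₀ + S + R,
      -- deg D ≥ (deg i₀ + m) + R, and 1 + S ≤ α since {i₀} ∪ S is independent.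
      heavy-count : Heavy Ĝ D (base i₀) → (∀ i i′ → distant-zero i ≡ true → distant-zero i′ ≡ true → adj G i i′ ≡ false) → ⊥
      heavy-count heavy independent = ℕP.1+n≰n (begin
        suc (m + m)                       ≡⟨ cong (λ k → suc (k + m)) m-partition ⟩
        suc ((1 + (d + (S + R))) + m)     ≡⟨ cong suc (rearrange d S R m) ⟩
        suc ((R + (d + m)) + (1 + S))     ≤⟨ s≤s (ℕP.+-mono-≤ (ℕP.+-monoʳ-≤ R (subst (_≤ D (base i₀)) (valence-base i₀) heavy)) with-i₀-bound) ⟩
        suc ((R + D (base i₀)) + a)       ≤⟨ s≤s (ℕP.+-monoˡ-≤ a D-bound) ⟩
        suc (Σℕ D + a)                    ≤⟨ deg-small ⟩
        m + m                             ∎)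
        where
        open ℕP.≤-Reasoning
        d S R : ℕ
        d = degree i₀
        S = Σℕ (b2n ∘ distant-zero)
        R = Σℕ (b2n ∘ distant-nonzero)
        m-partition : m ≡ 1 + (d + (S + R))
        m-partition = begin-equality
          m                         ≡⟨ trans (sym (Σℕ-ones m)) (ΣN.sum-cong-≗ partition) ⟩
          Σℕ (λ i → δ i₀ i + (b2n (adj G i₀ i) + (b2n (distant-zero i) + b2n (distant-nonzero i))))
            ≡⟨ ΣN.∑-distrib-+ (δ i₀) _ ⟩
          Σℕ (δ i₀) + Σℕ (λ i → b2n (adj G i₀ i) + (b2n (distant-zero i) + b2n (distant-nonzero i)))
            ≡⟨ cong₂ _+_ (Σℕ-δ i₀) (trans (ΣN.∑-distrib-+ (b2n ∘ adj G i₀) _) (cong (λ k → d + k) (ΣN.∑-distrib-+ (b2n ∘ distant-zero) _))) ⟩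
          1 + (d + (S + R))         ∎
        with-i₀-bound : 1 + S ≤ a
        with-i₀-bound = subst (_≤ a)
          (trans (ΣN.sum-cong-≗ with-i₀-count) (trans (ΣN.∑-distrib-+ (δ i₀) (b2n ∘ distant-zero)) (cong (_+ S) (Σℕ-δ i₀))))
          (independent-count α-bound with-i₀ (with-i₀-independent independent))
        rearrange : ∀ d s r k → (1 + (d + (s + r))) + k ≡ (r + (d + k)) + (1 + s)
        rearrange = solve-∀
        at-i₀ : b2n (distant-nonzero i₀) + D (base i₀) ≤ D (base i₀) + 0
        at-i₀ rewrite distant-nonzero-i₀ = ℕP.≤-reflexive (sym (ℕP.+-identityʳ _))
        D-bound : R + D (base i₀) ≤ Σℕ D
        D-bound = begin
          R + D (base i₀)                ≤⟨ Σℕ-mono-except i₀ distant-nonzero≤D at-i₀ ⟩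
          Σℕ (D ∘ base) + 0              ≡⟨ ℕP.+-identityʳ _ ⟩
          Σℕ (D ∘ base)                  ≤⟨ ℕP.m≤m+n _ _ ⟩
          Σℕ (D ∘ base) + Σℕ (D ∘ apex)  ≡⟨ Σℕ-splitAt m D ⟨
          Σℕ D                           ∎

      pair-with-heavy : Heavy Ĝ D (base i₀) → ObstructingPair Ĝ D
      pair-with-heavy heavy with edge-or-independent distant-zero
      ... | inj₂ independent = ⊥-elim (heavy-count heavy independent)
      ... | inj₁ (i , i′ , far-i , far-i′ , ii′) = record
        { Dv≡0 = vanishes⇒0 (proj₂ (distant-zero⇒ far-i)) ; Dx≡0 = vanishes⇒0 (proj₂ (distant-zero⇒ far-i′))
        ; adjacent = trans (adj-base-base i i′) ii′
        ; far = λ u heavy-u → subst (λ w → adj Ĝ w (base i) ≡ false × adj Ĝ w (base i′) ≡ false) (sym (heavy-unique heavy-u heavy))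
                  (trans (adj-base-base i₀ i) (proj₁ (distant-zero⇒ far-i)) , trans (adj-base-base i₀ i′) (proj₁ (distant-zero⇒ far-i′))) }

    obstructing-pair : ObstructingPair Ĝ D
    obstructing-pair with any? (λ u → valence Ĝ u ℕP.≤? D u)
    ... | no  light = pair-without-heavy (λ u heavy → light (u , heavy))
    ... | yes (u , heavy) with vertex u
    ...   | is-base i₀ = pair-with-heavy i₀ heavy
    ...   | is-apex j  = ⊥-elim (apex-light j heavy)

  -- A scramble of order 2m − α

  data EggShape : Subset N → Set where
    apex-singleton : ∀ j → EggShape ⁅ apex j ⁆
    base-edge      : ∀ {i i′} → adj G i i′ ≡ true → EggShape (⁅ base i ⁆ ∪ ⁅ base i′ ⁆)

  adjacent? : (e : Fin m × Fin m) → Dec (adj G (proj₁ e) (proj₂ e) ≡ true)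
  adjacent? e = adj G (proj₁ e) (proj₂ e) Bool.≟ true

  pairs : List.List (Fin m × Fin m)
  pairs = List.cartesianProduct (List.allFin m) (List.allFin m)

  edges : List.List (Fin m × Fin m)
  edges = List.filter adjacent? pairs

  edge-egg : Fin m × Fin m → Subset N
  edge-egg (i , i′) = ⁅ base i ⁆ ∪ ⁅ base i′ ⁆

  apex-eggs eggs : List.List (Subset N)
  apex-eggs = List.map (λ j → ⁅ apex j ⁆) (List.allFin m)
  eggs      = apex-eggs List.++ List.map edge-egg edges

  egg-shape : ∀ {E} → E ∈ₗ eggs → EggShape E
  egg-shape E∈ with ∈-++⁻ apex-eggs E∈
  ... | inj₁ E∈apexes with ∈-map⁻ (λ j → ⁅ apex j ⁆) E∈apexes
  ...   | j , _ , refl = apex-singleton j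
  egg-shape E∈ | inj₂ E∈edges with ∈-map⁻ edge-egg E∈edges
  ...   | (i , i′) , e∈ , refl = base-edge (proj₂ (∈-filter⁻ adjacent? {xs = pairs} e∈))

  apex-singleton∈ : ∀ j → ⁅ apex j ⁆ ∈ₗ eggs
  apex-singleton∈ j = ∈-++⁺ˡ (∈-map⁺ (λ j → ⁅ apex j ⁆) (∈-allFin j))

  base-edge∈ : ∀ {i i′} → adj G i i′ ≡ true → (⁅ base i ⁆ ∪ ⁅ base i′ ⁆) ∈ₗ eggs
  base-edge∈ {i} {i′} ii′ =
    ∈-++⁺ʳ apex-eggs (∈-map⁺ edge-egg (∈-filter⁺ adjacent? (∈-cartesianProduct⁺ (∈-allFin i) (∈-allFin i′)) ii′))

  eggs-scramble : IsScramble Ĝ eggs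
  eggs-scramble E E∈ with egg-shape E∈
  ... | apex-singleton j = (apex j , x∈⁅x⁆ (apex j)) , singleton-connected
    where
    singleton-connected : InducesConnected Ĝ ⁅ apex j ⁆
    singleton-connected u v u∈ v∈ rewrite x∈⁅y⁆⇒x≡y (apex j) u∈ | x∈⁅y⁆⇒x≡y (apex j) v∈ = ε
  ... | base-edge {i} {i′} ii′ = (base i , left∈pair (base i) (base i′)) , edge-connected
    where
    edge-connected : InducesConnected Ĝ (⁅ base i ⁆ ∪ ⁅ base i′ ⁆)
    edge-connected u v u∈ v∈ with ∈pair⁻ u∈ | ∈pair⁻ v∈
    ... | inj₁ refl | inj₁ refl = ε
    ... | inj₂ refl | inj₂ refl = ε
    ... | inj₁ refl | inj₂ refl = (u∈ , v∈ , trans (adj-base-base i i′) ii′) ◅ ε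
    ... | inj₂ refl | inj₁ refl = (u∈ , v∈ , trans (adj-base-base i′ i) (trans (adjSym G i′ i) ii′)) ◅ ε

  module _ {a} (α-bound : ∀ S → Independent G S → ∣ S ∣ ≤ a) where

    hitting≥ : ∀ H → Hits eggs H → N ∸ a ≤ ∣ H ∣
    hitting≥ H hits = begin
      N ∸ a                ≤⟨ ℕP.∸-monoʳ-≤ N (independent-count α-bound missed missed-independent) ⟩
      N ∸ Σℕ (b2n ∘ missed) ≡⟨ cong (_∸ Σℕ (b2n ∘ missed)) ∣H∣+missed ⟨
      ∣ H ∣ + Σℕ (b2n ∘ missed) ∸ Σℕ (b2n ∘ missed) ≡⟨ ℕP.m+n∸n≡m ∣ H ∣ (Σℕ (b2n ∘ missed)) ⟩
      ∣ H ∣                ∎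
      where
      open ℕP.≤-Reasoning
      missed : Fin m → Bool
      missed i = not (lookup H (base i))
      missed-hit : ∀ {i} → missed i ≡ true → lookup H (base i) ≢ true
      missed-hit i-missed i∈H with trans (cong not (sym i∈H)) i-missed
      ... | ()
      missed-independent : ∀ i i′ → missed i ≡ true → missed i′ ≡ true → adj G i i′ ≡ false
      missed-independent i i′ i-missed i′-missed with adj G i i′ in ii′
      ... | false = refl
      ... | true with hit-pair (hits _ (base-edge∈ ii′))
      ...   | inj₁ i∈H  = ⊥-elim (missed-hit i-missed i∈H)
      ...   | inj₂ i′∈H = ⊥-elim (missed-hit i′-missed i′∈H)
      ∣H∣+missed : ∣ H ∣ + Σℕ (b2n ∘ missed) ≡ N
      ∣H∣+missed = begin-equality
        ∣ H ∣ + Σℕ (b2n ∘ missed)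
          ≡⟨ cong (_+ Σℕ (b2n ∘ missed)) (trans (∣p∣≡Σℕ H) (Σℕ-splitAt m (b2n ∘ lookup H))) ⟩
        Σℕ (b2n ∘ lookup H ∘ base) + Σℕ (b2n ∘ lookup H ∘ apex) + Σℕ (b2n ∘ missed)
          ≡⟨ cong (λ k → Σℕ (b2n ∘ lookup H ∘ base) + k + Σℕ (b2n ∘ missed))
                  (trans (ΣN.sum-cong-≗ (λ j → cong b2n (hit-singleton (hits _ (apex-singleton∈ j))))) (Σℕ-ones m)) ⟩
        Σℕ (b2n ∘ lookup H ∘ base) + m + Σℕ (b2n ∘ missed)
          ≡⟨ xy∙z≈xz∙y (Σℕ (b2n ∘ lookup H ∘ base)) m _ ⟩
        Σℕ (b2n ∘ lookup H ∘ base) + Σℕ (b2n ∘ missed) + m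
          ≡⟨ cong (_+ m) (trans (sym (ΣN.∑-distrib-+ (b2n ∘ lookup H ∘ base) (b2n ∘ missed)))
                                (trans (ΣN.sum-cong-≗ (b2n+b2n∘not ∘ lookup H ∘ base)) (Σℕ-ones m))) ⟩
        N ∎

    cut≥ : 1 ≤ a → ∀ A → Separates eggs A → N ∸ a ≤ cutSize Ĝ A
    cut≥ 1≤a A ((E₁ , E₁∈ , E₁⊆A) , (E₂ , E₂∈ , E₂⊆∁A)) with apex-split A
    ... | mixed j∈A j′∉A = ℕP.≤-trans (ℕP.∸-monoʳ-≤ N 1≤a) (ℕP.m≤n+o⇒m∸n≤o N 1 (cut-mixed-apexes A j∈A j′∉A))
    ... | all-in apexes-in = ℕP.≤-trans (ℕP.m∸n≤m N a) (outside (egg-shape E₂∈) E₂⊆∁A)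
      where
      outside : ∀ {E} → EggShape E → E ⊆ ∁ A → N ≤ cutSize Ĝ A
      outside (apex-singleton j) E⊆∁A = ⊥-elim (Bool.not-¬ (apexes-in j) (∈∁⇒lookup E⊆∁A (x∈⁅x⁆ (apex j))))
      outside (base-edge {i} {i′} ii′) E⊆∁A = cut-two-bases-outside A (adj⇒≢ G ii′)
        (∈∁⇒lookup E⊆∁A (left∈pair (base i) (base i′))) (∈∁⇒lookup E⊆∁A (right∈pair (base i) (base i′))) apexes-in
    ... | all-out apexes-out = ℕP.≤-trans (ℕP.m∸n≤m N a) (inside (egg-shape E₁∈) E₁⊆A)
      where
      inside : ∀ {E} → EggShape E → E ⊆ A → N ≤ cutSize Ĝ A
      inside (apex-singleton j) E⊆A = ⊥-elim (Bool.not-¬ (∈⇒lookup E⊆A (x∈⁅x⁆ (apex j))) (apexes-out j))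
      inside (base-edge {i} {i′} ii′) E⊆A = cut-two-bases-inside A (adj⇒≢ G ii′)
        (∈⇒lookup E⊆A (left∈pair (base i) (base i′))) (∈⇒lookup E⊆A (right∈pair (base i) (base i′))) apexes-out

  module _ {I : Subset m} (I-independent : Independent G I) where

    cover : Subset N
    cover = tabulate (λ x → [ not ∘ lookup I , (λ _ → true) ]′ (splitAt m x))

    cover-base : ∀ i → lookup cover (base i) ≡ not (lookup I i)
    cover-base i rewrite lookup∘tabulate (λ x → [ not ∘ lookup I , (λ _ → true) ]′ (splitAt m x)) (base i)
                       | splitAt-↑ˡ m i m = refl

    cover-apex : ∀ j → lookup cover (apex j) ≡ true
    cover-apex j rewrite lookup∘tabulate (λ x → [ not ∘ lookup I , (λ _ → true) ]′ (splitAt m x)) (apex j)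
                       | splitAt-↑ʳ m m j = refl

    uncovered-base : ∀ {i} → lookup cover (base i) ≡ false → lookup I i ≡ true
    uncovered-base {i} i∉ = Bool.¬-not (λ i∉I → Bool.not-¬ (trans (sym (cover-base i)) i∉) (cong not i∉I))

    neighbours-covered : ∀ {i i′} → lookup I i ≡ true → adj G i i′ ≡ true → lookup I i′ ≡ false
    neighbours-covered {i} {i′} i∈I ii′ with lookup I i′ in i′∈I
    ... | false = refl
    ... | true  = ⊥-elim (adj-both G ii′ (trans (adjSym G i′ i)
                    (I-independent i i′ (lookup⇒[]= i I i∈I) (lookup⇒[]= i′ I i′∈I))))

    cover-vertexCover : VertexCover Ĝ cover
    cover-vertexCover u w u∉ w∉ = go (vertex u) (vertex w) u∉ w∉
      where
      go : ∀ {u w} → ConeVertex u → ConeVertex w → lookup cover u ≡ false → lookup cover w ≡ false → adj Ĝ u w ≡ false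
      go (is-apex j) _ j∉ _ = ⊥-elim (Bool.not-¬ (cover-apex j) j∉)
      go _ (is-apex j) _ j∉ = ⊥-elim (Bool.not-¬ (cover-apex j) j∉)
      go (is-base i) (is-base i′) i∉ i′∉ with adj G i i′ in ii′
      ... | false = trans (adj-base-base i i′) ii′
      ... | true  = ⊥-elim (Bool.not-¬ (uncovered-base i′∉) (neighbours-covered (uncovered-base i∉) ii′))

    Σoutside-I : Σℕ (b2n ∘ not ∘ lookup I) ≡ m ∸ ∣ I ∣
    Σoutside-I = trans (ΣN.sum-cong-≗ (λ i → cong b2n (sym (lookup-map i not I))))
                       (trans (sym (∣p∣≡Σℕ (∁ I))) (∣∁p∣≡n∸∣p∣ I))

    ∣cover∣ : ∣ cover ∣ ≡ N ∸ ∣ I ∣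
    ∣cover∣ = begin
      ∣ cover ∣                                                  ≡⟨ ∣p∣≡Σℕ cover ⟩
      Σℕ (b2n ∘ lookup cover)                                    ≡⟨ Σℕ-splitAt m (b2n ∘ lookup cover) ⟩
      Σℕ (b2n ∘ lookup cover ∘ base) + Σℕ (b2n ∘ lookup cover ∘ apex)
          ≡⟨ cong₂ _+_ (trans (ΣN.sum-cong-≗ (cong b2n ∘ cover-base)) Σoutside-I)
                       (trans (ΣN.sum-cong-≗ (cong b2n ∘ cover-apex)) (Σℕ-ones m)) ⟩
      (m ∸ ∣ I ∣) + m                                            ≡⟨ ℕP.+-∸-comm m (∣p∣≤n I) ⟨
      N ∸ ∣ I ∣                                                  ∎
      where open ≡-Reasoning

    cover-hits : ∀ {E} → EggShape E → Nonempty (E ∩ cover)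
    cover-hits (apex-singleton j) = apex j , x∈p∩q⁺ (x∈⁅x⁆ (apex j) , lookup⇒[]= (apex j) cover (cover-apex j))
    cover-hits (base-edge {i} {i′} ii′) with lookup I i in i∈I
    ... | false = base i , x∈p∩q⁺ (left∈pair (base i) (base i′) , lookup⇒[]= (base i) cover (trans (cover-base i) (cong not i∈I)))
    ... | true  = base i′ , x∈p∩q⁺ (right∈pair (base i) (base i′) ,
                    lookup⇒[]= (base i′) cover (trans (cover-base i′) (cong not (neighbours-covered i∈I ii′))))

    valence-uncovered : ∀ u → lookup cover u ≡ false → valence Ĝ u ≤ N ∸ ∣ I ∣
    valence-uncovered u u∉ with vertex u
    ... | is-apex j = ⊥-elim (Bool.not-¬ (cover-apex j) u∉)
    ... | is-base i = begin
      valence Ĝ (base i)           ≡⟨ valence-base i ⟩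
      degree i + m                 ≤⟨ ℕP.+-monoˡ-≤ m (subst (degree i ≤_) Σoutside-I (Σℕ-mono-≤ neighbour-outside)) ⟩
      (m ∸ ∣ I ∣) + m              ≡⟨ ℕP.+-∸-comm m (∣p∣≤n I) ⟨
      N ∸ ∣ I ∣                    ∎
      where
      open ℕP.≤-Reasoning
      neighbour-outside : ∀ i′ → b2n (adj G i i′) ≤ b2n (not (lookup I i′))
      neighbour-outside i′ with adj G i i′ in ii′
      ... | false = z≤n
      ... | true rewrite neighbours-covered (uncovered-base u∉) ii′ = ℕP.≤-refl


  module _ (1≤m : 1 ≤ m) {a} (α-bound : ∀ S → Independent G S → ∣ S ∣ ≤ a) (1≤a : 1 ≤ a) (a≤N : a ≤ N) where

    firing-degree≥ : ∀ (D : Fin N → ℕ) → FiringPositiveRank Ĝ (+_ ∘ D) → N ∸ a ≤ Σℕ D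
    firing-degree≥ D firing with N ∸ a ℕP.≤? Σℕ D
    ... | yes bound = bound
    ... | no  ¬bound = ⊥-elim (obstructed Ĝ cone-small-cuts-isolate D (small 1≤m α-bound 1≤a D deg-small)
                                          (obstructing-pair 1≤m α-bound 1≤a D deg-small) firing)
      where
      deg-small : suc (Σℕ D + a) ≤ N
      deg-small = ℕP.m≤o∸n⇒m+n≤o (suc (Σℕ D)) a≤N (ℕP.≰⇒> ¬bound)

    gonality≥ : ∀ D → PositiveRank Ĝ D → + (N ∸ a) ℤ.≤ deg D
    gonality≥ D positive with effective-representative Ĝ (base (fromℕ< 1≤m)) (positiveRank⇒firing Ĝ {D} positive)
    ... | D′ , deg-D′ , firing′ = subst (+ (N ∸ a) ℤ.≤_) (trans deg-D′ (sym (sumℤ-allFin D))) (+≤+ (firing-degree≥ D′ firing′))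

  module _ (1≤m : 1 ≤ m) {I : Subset m} (I-independent : Independent G I)
           (α-bound : ∀ S → Independent G S → ∣ S ∣ ≤ ∣ I ∣) where

    1≤∣I∣ : 1 ≤ ∣ I ∣
    1≤∣I∣ = subst (_≤ ∣ I ∣) (∣⁅x⁆∣≡1 i) (α-bound ⁅ i ⁆ singleton-independent)
      where
      i = fromℕ< 1≤m
      singleton-independent : Independent G ⁅ i ⁆
      singleton-independent u v u∈ v∈ rewrite x∈⁅y⁆⇒x≡y i u∈ | x∈⁅y⁆⇒x≡y i v∈ = irrefl G i

    ∣I∣≤N : ∣ I ∣ ≤ N
    ∣I∣≤N = ℕP.≤-trans (∣p∣≤n I) (ℕP.m≤m+n m m)

    every-scramble-order≤ : ∀ Sc → IsScramble Ĝ Sc → OrderAtMost Ĝ Sc (N ∸ ∣ I ∣)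
    every-scramble-order≤ = scramble-order≤ Ĝ {cover I-independent} (cover-vertexCover I-independent) (ℕP.≤-reflexive (∣cover∣ I-independent))
      (ℕP.≤-trans 1≤m (ℕP.≤-trans (ℕP.m≤n+m m (m ∸ ∣ I ∣)) (ℕP.≤-reflexive (sym (ℕP.+-∸-comm m (∣p∣≤n I))))))
      (valence-uncovered I-independent)

    scramble-number : IsScrambleNumber Ĝ (N ∸ ∣ I ∣)
    scramble-number =
      (eggs , eggs-scramble ,
        (hitting≥ α-bound , cut≥ α-bound 1≤∣I∣) ,
        inj₁ (cover I-independent , (λ E E∈ → cover-hits I-independent (egg-shape E∈)) , ℕP.≤-reflexive (∣cover∣ I-independent))) ,
      λ Sc o scramble order → order-bound {H = Ĝ} (proj₁ order) (every-scramble-order≤ Sc scramble)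

    gonality : IsGonality Ĝ (N ∸ ∣ I ∣)
    gonality =
      (indicator (cover I-independent) ,
        indicator-positiveRank Ĝ {cover I-independent} (cover-vertexCover I-independent) (λ u _ → ℕP.≤-trans 1≤m (m≤valence 1≤m u)) ,
        trans (deg-indicator (cover I-independent)) (cong +_ (∣cover∣ I-independent))) ,
      gonality≥ 1≤m α-bound 1≤∣I∣ ∣I∣≤N

lemma3p5 : (m : ℕ) (G : SimpleGraph m) → 2 ≤ m → Connected G →
    (a : ℕ) → IsIndependenceNumber G a →
    IsScrambleNumber (cone G m) ((m + m) ∸ a) × IsGonality (cone G m) ((m + m) ∸ a)
lemma3p5 m G 2≤m _ a ((I , I-independent , refl) , α-bound) =
  scramble-number 1≤m I-independent α-bound , gonality 1≤m I-independent α-bound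
  where
  open Cone G
  1≤m : 1 ≤ m
  1≤m = ℕP.≤-trans (s≤s z≤n) 2≤m
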